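{- Let $G$ be a finite abelian group of order $r$ and exponent greater than $2$. Among all inverse-closed subsets $S$ of $G$: (a) the proportion with $\mathrm{Cay}(G,S)$ disconnected is at most $2^{ -r/4+(\log_2r)^2}$; (b) the proportion with $\mathrm{Cay}(G,S)$ connected and bipartite is at most $2^{ -r/4+(\log_2r)^2}$; (c) the proportion with $\mathrm{Cay}(G,S)$ not twin-free is at most $2^{ -r/6+\log_2r+1}$.
   Context: $\mathrm{Cay}(G,S)$ has vertex set $G$, $x\sim y$ iff $yx^{ -1}\in S$ (loops if $1\in S$). Twin-free: no two distinct vertices have the same neighbourhood. -}

module Defs where

open import Level using (0ℓ)
open import Data.Nat using (ℕ; zero; suc; _+_; _*_; _^_; _≤_; _<_)
open import Data.Bool using (Bool; true; false)
open import Data.Fin using (Fin)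
open import Data.Fin.Subset using (Subset; _∈_)
open import Data.Fin.Subset.Properties using (_∈?_)
open import Data.Fin.Properties using (all?)
open import Data.Vec using (Vec; []; _∷_)
open import Data.List using (List; []; _∷_; map; _++_; length; filter)
open import Data.Product using (Σ; ∃; _×_; _,_)
open import Relation.Binary.PropositionalEquality using (_≡_; _≢_)
open import Relation.Binary.Construct.Closure.ReflexiveTransitive using (Star)
open import Relation.Nullary using (¬_; Dec; yes; no)
open import Relation.Nullary.Decidable using (_→-dec_)
open import Algebra.Structures using (IsAbelianGroup)

-- A finite abelian group of order r, presented (up to isomorphism) with
-- carrier Fin r and propositional equality.

record FinAbGroup (r : ℕ) : Set where
  field
    _∙_   : Fin r → Fin r → Fin r
    ε     : Fin r
    _⁻¹   : Fin r → Fin r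
    isAbelianGroup : IsAbelianGroup _≡_ _∙_ ε _⁻¹

  infixl 7 _∙_
  infix  8 _⁻¹

  pow : Fin r → ℕ → Fin r
  pow x zero    = ε
  pow x (suc n) = x ∙ pow x n

open FinAbGroup public

ExponentGreaterThan2 : ∀ {r} → FinAbGroup r → Set
ExponentGreaterThan2 G = ∀ n → 1 ≤ n → n ≤ 2 → ¬ (∀ x → pow G x n ≡ ε G)

InvClosed : ∀ {r} → FinAbGroup r → Subset r → Set
InvClosed G S = ∀ x → x ∈ S → _⁻¹ G x ∈ S

invClosed? : ∀ {r} (G : FinAbGroup r) (S : Subset r) → Dec (InvClosed G S)
invClosed? G S = all? (λ x → (x ∈? S) →-dec (_⁻¹ G x ∈? S))

Adj : ∀ {r} → FinAbGroup r → Subset r → Fin r → Fin r → Set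
Adj G S x y = _∙_ G y (_⁻¹ G x) ∈ S

Connected : ∀ {r} → FinAbGroup r → Subset r → Set
Connected G S = ∀ x y → Star (Adj G S) x y

Bipartite : ∀ {r} → FinAbGroup r → Subset r → Set
Bipartite G S = Σ (Fin _ → Bool) λ c → ∀ x y → Adj G S x y → c x ≢ c y

TwinFree : ∀ {r} → FinAbGroup r → Subset r → Set
TwinFree G S = ∀ x y → (∀ z → (Adj G S x z → Adj G S y z) × (Adj G S y z → Adj G S x z)) → x ≡ y

allSubsets : ∀ n → List (Subset n)
allSubsets zero    = [] ∷ []
allSubsets (suc n) = map (true ∷_) (allSubsets n) ++ map (false ∷_) (allSubsets n)

numInvClosed : ∀ {r} → FinAbGroup r → ℕ
numInvClosed {r} G = length (filter (invClosed? G) (allSubsets r))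

-- Log2RatioLeKSqLog2 X Y k r  means   log₂(X/Y) ≤ k · (log₂ r)²
-- (for Y > 0, r ≥ 1; log₂ 0 = -∞), via density of the rationals:
--   for all p/q < log₂(X/Y)   [i.e. 2^p · Y^q < X^q],
--   and all s/t < √(p/(k q))  [i.e. s² k q < p t²],
--   we have s/t ≤ log₂ r      [i.e. 2^s ≤ r^t].
Log2RatioLeKSqLog2 : ℕ → ℕ → ℕ → ℕ → Set
Log2RatioLeKSqLog2 X Y k r =
  ∀ p q → 0 < q → 2 ^ p * Y ^ q < X ^ q →
  ∀ s t → 0 < t → s * s * k * q < p * t * t → 2 ^ s ≤ r ^ t

-- a / b ≤ 2^(-r/4 + (log₂ r)²)
--   ⇔ log₂(a⁴·2^r / b⁴) ≤ 4 (log₂ r)²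
RatioLeBoundAB : ℕ → ℕ → ℕ → Set
RatioLeBoundAB a b r = Log2RatioLeKSqLog2 (a ^ 4 * 2 ^ r) (b ^ 4) 4 r

-- a / b ≤ 2^(-r/6 + log₂ r + 1) = 2r · 2^(-r/6)
--   ⇔ a⁶ · 2^r ≤ (2 r b)⁶
RatioLeBoundC : ℕ → ℕ → ℕ → Set
RatioLeBoundC a b r = a ^ 6 * 2 ^ r ≤ (2 * r * b) ^ 6

{-# OPTIONS --safe #-}
module Submission where

-- Each bound is a compression argument. To every S in the family attach a code, taken from a
-- small set of codes, and k inverse pairs {x, x⁻¹} whose membership in S is irrelevant once the
-- code is known. Overwriting those pairs by k arbitrary bits is then injective, so
-- |L| · 2^k ≤ #codes · #(inverse-closed sets).
--  (a) S lies in the proper subgroup H = ⟨S⟩, which ⌊log₂ r⌋ elements of S generate (the code);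
--      the at least r/2 elements outside H contain at least r/4 free pairs.
--  (b) A proper colouring of a connected Cayley graph is a character; its kernel H has index 2
--      and misses S. H is coded by ⌊log₂ r⌋ generators and contains at least r/4 free pairs.
--  (c) Twins x ≠ y make S periodic with period h = xy⁻¹ (the code). S is then constant on the
--      orbits of z ↦ hᵐz^±1, and all inverse pairs of an orbit but one, at least r/6 in total,
--      are free.
-- Finally r^⌊log₂ r⌋ ≤ 2^((log₂ r)²).

open import Defs hiding (_∙_; ε; _⁻¹; pow)
open import Level using (0ℓ)
open import Algebra.Bundles using (AbelianGroup)
import Algebra.Properties.AbelianGroup as AbelianGroupProperties
import Algebra.Properties.CommutativeSemigroup as CommutativeSemigroupProperties
open import Data.Nat
  using (ℕ; zero; suc; _+_; _*_; _^_; _∸_; _/_; _%_; _≤_; _<_; z≤n; s≤s; _≤?_; _<?_; NonZero; >-nonZero⁻¹)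
open import Data.Nat.Properties
open import Data.Nat.DivMod using (m≡m%n+[m/n]*n; m%n<n; m<n*o⇒m/o<n)
open import Data.Nat.Tactic.RingSolver using (solve-∀)
open import Data.Bool using (Bool; true; false; not) renaming (_≟_ to _≟ᵇ_)
open import Data.Bool.Properties using (¬-not)
open import Data.Maybe using (Maybe; just; nothing; fromMaybe; maybe)
open import Data.Fin using (Fin; toℕ; fromℕ<; inject≤)
import Data.Fin.Properties as Fin
open import Data.Fin.Subset using (Subset; _∈_; _∉_)
open import Data.Fin.Subset.Properties using (_∈?_)
open import Data.Vec using (Vec; []; _∷_; lookup; tabulate; replicate)
import Data.Vec.Properties as Vec
open import Data.Vec.Relation.Unary.All using ([]; _∷_) renaming (All to AllV)
open import Data.List
  using (List; []; _∷_; map; _++_; length; filter; head; cartesianProductWith; cartesianProduct; allFin)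
import Data.List as List
open import Data.List.Properties using (length-++; length-map; length-tabulate; filter-all; filter-none; filter-≐)
open import Data.List.Membership.Propositional using () renaming (_∈_ to _∈ₗ_)
open import Data.List.Membership.Propositional.Properties
open import Data.List.Relation.Unary.Any as Any using (Any; here; there)
open import Data.List.Relation.Unary.All as All using (All)
open import Data.List.Relation.Unary.AllPairs using ([]; _∷_)
open import Data.List.Relation.Unary.Unique.Propositional using (Unique)
import Data.List.Relation.Unary.Unique.Propositional.Properties as Unique
open import Data.Product using (∃; ∃₂; _×_; _,_; proj₁; proj₂)
open import Data.Sum using (_⊎_; inj₁; inj₂)
open import Function using (_∘_)
open import Relation.Binary.PropositionalEquality
open import Relation.Binary.Construct.Closure.ReflexiveTransitive using (Star; _◅_; _◅◅_; gmap) renaming (ε to [])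
open import Relation.Nullary using (¬_; Dec; yes; no; contradiction)
open import Relation.Nullary.Decidable using (_×-dec_; _⊎-dec_; _→-dec_; ¬?; decidable-stable)
open import Relation.Unary using (Pred; Decidable; _⊆_; _≐_; _∩_; ∁; U)
open import Relation.Unary.Properties using (U?; ∅?; ∁?; _∩?_)

length≤-by-injection : ∀ {A B : Set} (f : A → B) {xs : List A} (ys : List B) → Unique xs →
  (∀ {x} → x ∈ₗ xs → f x ∈ₗ ys) →
  (∀ {x y} → x ∈ₗ xs → y ∈ₗ xs → f x ≡ f y → x ≡ y) → length xs ≤ length ys
length≤-by-injection f {[]} ys _ _ _ = z≤n
length≤-by-injection f {x ∷ xs} ys (x∉xs ∷ uxs) maps inj with ∈-∃++ (maps (here refl))
... | ys₁ , ys₂ , refl = begin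
    suc (length xs)               ≤⟨ s≤s (length≤-by-injection f (ys₁ ++ ys₂) uxs maps′ inj′) ⟩
    suc (length (ys₁ ++ ys₂))     ≡⟨ cong suc (length-++ ys₁) ⟩
    suc (length ys₁ + length ys₂) ≡⟨ +-suc (length ys₁) (length ys₂) ⟨
    length ys₁ + suc (length ys₂) ≡⟨ length-++ ys₁ ⟨
    length (ys₁ ++ f x ∷ ys₂)     ∎
  where
  open ≤-Reasoning
  inj′ : ∀ {a b} → a ∈ₗ xs → b ∈ₗ xs → f a ≡ f b → a ≡ b
  inj′ a∈ b∈ = inj (there a∈) (there b∈)
  maps′ : ∀ {a} → a ∈ₗ xs → f a ∈ₗ ys₁ ++ ys₂
  maps′ {a} a∈ with ∈-++⁻ ys₁ (maps (there a∈))
  ... | inj₁ m = ∈-++⁺ˡ m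
  ... | inj₂ (here fa≡fx) = contradiction (sym (inj (there a∈) (here refl) fa≡fx)) (All.lookup x∉xs a∈)
  ... | inj₂ (there m) = ∈-++⁺ʳ ys₁ m

length-cartesianProductWith : ∀ {A B C : Set} (f : A → B → C) (xs : List A) (ys : List B) →
  length (cartesianProductWith f xs ys) ≡ length xs * length ys
length-cartesianProductWith f [] ys = refl
length-cartesianProductWith f (x ∷ xs) ys = begin
  length (map (f x) ys ++ cartesianProductWith f xs ys)          ≡⟨ length-++ (map (f x) ys) ⟩
  length (map (f x) ys) + length (cartesianProductWith f xs ys)
    ≡⟨ cong₂ _+_ (length-map (f x) ys) (length-cartesianProductWith f xs ys) ⟩
  length ys + length xs * length ys                             ∎
  where open ≡-Reasoning

length-allFin : ∀ n → length (allFin n) ≡ n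
length-allFin n = length-tabulate _

module _ {n : ℕ} where

  elements : ∀ {p} {P : Pred (Fin n) p} → Decidable P → List (Fin n)
  elements P? = filter P? (allFin n)

  count : ∀ {p} {P : Pred (Fin n) p} → Decidable P → ℕ
  count P? = length (elements P?)

  module _ {p} {P : Pred (Fin n) p} (P? : Decidable P) where

    elements-unique : Unique (elements P?)
    elements-unique = Unique.filter⁺ P? (Unique.allFin⁺ n)

    ∈-elements⁺ : ∀ {x} → P x → x ∈ₗ elements P?
    ∈-elements⁺ = ∈-filter⁺ P? (∈-allFin _)

    ∈-elements⁻ : ∀ {x} → x ∈ₗ elements P? → P x
    ∈-elements⁻ m = proj₂ (∈-filter⁻ P? {xs = allFin n} m)

    count≤n : count P? ≤ n
    count≤n = subst (count P? ≤_) (length-allFin n)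
      (length≤-by-injection (λ x → x) (allFin n) elements-unique (λ _ → ∈-allFin _) (λ _ _ e → e))

    count-pos : ∀ {z} → P z → 0 < count P?
    count-pos {z} pz = length≤-by-injection (λ x → x) (elements P?) (All.[] ∷ [])
      (λ { (here refl) → ∈-elements⁺ pz }) (λ { (here refl) (here refl) _ → refl })

  count-U : count U? ≡ n
  count-U = trans (cong length (filter-all U? {xs = allFin n} (All.universal _ _))) (length-allFin n)

  count-none : ∀ {p} {P : Pred (Fin n) p} (P? : Decidable P) → (∀ x → ¬ P x) → count P? ≡ 0
  count-none P? none = cong length (filter-none P? {xs = allFin n} (All.universal none _))

  count-∅ : count ∅? ≡ 0
  count-∅ = count-none ∅? (λ _ ())

count≤-by-injection : ∀ {n m p q} {P : Pred (Fin n) p} {Q : Pred (Fin m) q} (P? : Decidable P) (Q? : Decidable Q)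
  (f : Fin n → Fin m) → (∀ {x y} → f x ≡ f y → x ≡ y) → (∀ {x} → P x → Q (f x)) → count P? ≤ count Q?
count≤-by-injection P? Q? f f-inj maps = length≤-by-injection f (elements Q?) (elements-unique P?)
  (λ m → ∈-elements⁺ Q? (maps (∈-elements⁻ P? m))) (λ _ _ → f-inj)

count-mono : ∀ {n p q} {P : Pred (Fin n) p} {Q : Pred (Fin n) q} (P? : Decidable P) (Q? : Decidable Q) →
  P ⊆ Q → count P? ≤ count Q?
count-mono P? Q? = count≤-by-injection P? Q? (λ x → x) (λ e → e)

count-disjoint : ∀ {n p q r} {P : Pred (Fin n) p} {Q : Pred (Fin n) q} {R : Pred (Fin n) r}
  (P? : Decidable P) (Q? : Decidable Q) (R? : Decidable R) →
  (∀ {x} → P x → ¬ Q x) → P ⊆ R → Q ⊆ R → count P? + count Q? ≤ count R?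
count-disjoint P? Q? R? disjoint P⊆R Q⊆R = subst (_≤ count R?) (length-++ (elements P?))
  (length≤-by-injection (λ x → x) (elements R?)
    (Unique.++⁺ (elements-unique P?) (elements-unique Q?)
      (λ (p , q) → disjoint (∈-elements⁻ P? p) (∈-elements⁻ Q? q)))
    maps (λ _ _ e → e))
  where
  maps : ∀ {x} → x ∈ₗ elements P? ++ elements Q? → x ∈ₗ elements R?
  maps m with ∈-++⁻ (elements P?) m
  ... | inj₁ p = ∈-elements⁺ R? (P⊆R (∈-elements⁻ P? p))
  ... | inj₂ q = ∈-elements⁺ R? (Q⊆R (∈-elements⁻ Q? q))

module _ {n m f} {F : Pred (Fin n) f} (F? : Decidable F) (τ : Fin m → Fin n → Fin n) where

  Image : Pred (Fin n) f
  Image x = ∃₂ λ j y → F y × x ≡ τ j y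

  image? : Decidable Image
  image? x = Fin.any? λ j → Fin.any? λ y → F? y ×-dec (x Fin.≟ τ j y)

  count-cover∪ : ∀ {d e} {D : Pred (Fin n) d} {E : Pred (Fin n) e} (D? : Decidable D) (E? : Decidable E) →
    (∀ {x} → D x → E x ⊎ Image x) → count D? ≤ m * count F? + count E?
  count-cover∪ {D = D} {E} D? E? cover = begin
    count D?                        ≤⟨ length≤-by-injection classify codes (elements-unique D?) maps inj ⟩
    length codes                    ≡⟨ length-++ (map inj₁ (elements E?)) ⟩
    length (map inj₁ (elements E?)) + length (map inj₂ pairs)
                                    ≡⟨ cong₂ _+_ (length-map inj₁ (elements E?)) (length-map inj₂ pairs) ⟩
    count E? + length pairs         ≡⟨ cong (count E? +_) (length-cartesianProductWith _,_ (allFin m) (elements F?)) ⟩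
    count E? + length (allFin m) * count F? ≡⟨ cong (λ k → count E? + k * count F?) (length-allFin m) ⟩
    count E? + m * count F?         ≡⟨ +-comm (count E?) _ ⟩
    m * count F? + count E?         ∎
    where
    open ≤-Reasoning
    pairs = cartesianProduct (allFin m) (elements F?)
    codes = map inj₁ (elements E?) ++ map inj₂ pairs

    classifyWith : ∀ x → Dec (E x) → Dec (Image x) → Fin n ⊎ (Fin m × Fin n)
    classifyWith x (no _) (yes (j , y , _)) = inj₂ (j , y)
    classifyWith x _      _                 = inj₁ x

    classify : Fin n → Fin n ⊎ (Fin m × Fin n)
    classify x = classifyWith x (E? x) (image? x)

    decode : Fin n ⊎ (Fin m × Fin n) → Fin n
    decode (inj₁ x)       = x
    decode (inj₂ (j , y)) = τ j y

    decode-classifyWith : ∀ x e? i? → decode (classifyWith x e? i?) ≡ x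
    decode-classifyWith x (yes _) _                      = refl
    decode-classifyWith x (no _)  (yes (_ , _ , _ , eq)) = sym eq
    decode-classifyWith x (no _)  (no _)                 = refl

    inj : ∀ {x y} → x ∈ₗ elements D? → y ∈ₗ elements D? → classify x ≡ classify y → x ≡ y
    inj {x} {y} _ _ eq = trans (sym (decode-classifyWith x (E? x) (image? x)))
      (trans (cong decode eq) (decode-classifyWith y (E? y) (image? y)))

    mapsWith : ∀ {x} e? i? → E x ⊎ Image x → classifyWith x e? i? ∈ₗ codes
    mapsWith (yes ex) _ _ = ∈-++⁺ˡ (∈-map⁺ inj₁ (∈-elements⁺ E? ex))
    mapsWith (no _) (yes (j , y , fy , _)) _ =
      ∈-++⁺ʳ _ (∈-map⁺ inj₂ (∈-cartesianProduct⁺ (∈-allFin j) (∈-elements⁺ F? fy)))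
    mapsWith (no ¬ex) (no _) (inj₁ ex) = contradiction ex ¬ex
    mapsWith (no _) (no ¬ix) (inj₂ ix) = contradiction ix ¬ix

    maps : ∀ {x} → x ∈ₗ elements D? → classify x ∈ₗ codes
    maps {x} m = mapsWith (E? x) (image? x) (cover (∈-elements⁻ D? m))

  count-cover : ∀ {d} {D : Pred (Fin n) d} (D? : Decidable D) → D ⊆ Image → count D? ≤ m * count F?
  count-cover D? cover = subst (count D? ≤_) (trans (cong (m * count F? +_) (count-∅ {n})) (+-identityʳ _))
    (count-cover∪ D? ∅? (λ d → inj₂ (cover d)))

lookup-injective : ∀ {A : Set} {xs : List A} → Unique xs → ∀ i j → List.lookup xs i ≡ List.lookup xs j → i ≡ j
lookup-injective {xs = _ ∷ _} _          Fin.zero    Fin.zero    _  = refl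
lookup-injective {xs = _ ∷ _} (x∉ ∷ _)   Fin.zero    (Fin.suc j) eq = contradiction eq (All.lookup x∉ (∈-lookup j))
lookup-injective {xs = _ ∷ _} (x∉ ∷ _)   (Fin.suc i) Fin.zero    eq = contradiction (sym eq) (All.lookup x∉ (∈-lookup i))
lookup-injective {xs = _ ∷ _} (_ ∷ uxs)  (Fin.suc i) (Fin.suc j) eq = cong Fin.suc (lookup-injective uxs i j eq)

module _ {n p} {P : Pred (Fin n) p} (P? : Decidable P) (default : Fin n) (k : ℕ) where

  -- default is returned only when fewer than k elements satisfy P.
  enumerate : Fin k → Fin n
  enumerate i with k ≤? count P?
  ... | yes k≤ = List.lookup (elements P?) (inject≤ i k≤)
  ... | no _   = default

  enumerate-∈ : k ≤ count P? → ∀ i → P (enumerate i)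
  enumerate-∈ k≤ i with k ≤? count P?
  ... | yes _   = ∈-elements⁻ P? (∈-lookup _)
  ... | no k≰ = contradiction k≤ k≰

  enumerate-injective : k ≤ count P? → ∀ i j → enumerate i ≡ enumerate j → i ≡ j
  enumerate-injective k≤ i j eq with k ≤? count P?
  ... | yes k≤′ = Fin.inject≤-injective k≤′ k≤′ i j (lookup-injective (elements-unique P?) _ _ eq)
  ... | no k≰   = contradiction k≤ k≰

length-allSubsets : ∀ n → length (allSubsets n) ≡ 2 ^ n
length-allSubsets zero    = refl
length-allSubsets (suc n) = begin
  length (map (true ∷_) (allSubsets n) ++ map (false ∷_) (allSubsets n))
    ≡⟨ length-++ (map (true ∷_) (allSubsets n)) ⟩
  length (map (true ∷_) (allSubsets n)) + length (map (false ∷_) (allSubsets n))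
    ≡⟨ cong₂ _+_ (length-map _ (allSubsets n)) (length-map _ (allSubsets n)) ⟩
  length (allSubsets n) + length (allSubsets n)
    ≡⟨ cong (λ m → m + m) (length-allSubsets n) ⟩
  2 ^ n + 2 ^ n
    ≡⟨ cong (2 ^ n +_) (+-identityʳ (2 ^ n)) ⟨
  2 ^ suc n ∎
  where open ≡-Reasoning

allSubsets-unique : ∀ n → Unique (allSubsets n)
allSubsets-unique zero    = All.[] ∷ []
allSubsets-unique (suc n) = Unique.++⁺ (Unique.map⁺ Vec.∷-injectiveʳ (allSubsets-unique n))
  (Unique.map⁺ Vec.∷-injectiveʳ (allSubsets-unique n)) disjoint
  where
  disjoint : ∀ {v} → ¬ (v ∈ₗ map (true ∷_) (allSubsets n) × v ∈ₗ map (false ∷_) (allSubsets n))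
  disjoint (t , f) with ∈-map⁻ (true ∷_) t | ∈-map⁻ (false ∷_) f
  ... | _ , _ , refl | _ , _ , ()

∈-allSubsets : ∀ {n} (S : Subset n) → S ∈ₗ allSubsets n
∈-allSubsets []            = here refl
∈-allSubsets (true ∷ S)    = ∈-++⁺ˡ (∈-map⁺ (true ∷_) (∈-allSubsets S))
∈-allSubsets {suc n} (false ∷ S) = ∈-++⁺ʳ (map (true ∷_) (allSubsets n)) (∈-map⁺ (false ∷_) (∈-allSubsets S))

allVectors : ∀ {A : Set} → List A → ∀ k → List (Vec A k)
allVectors xs zero    = [] ∷ []
allVectors xs (suc k) = cartesianProductWith _∷_ xs (allVectors xs k)

length-allVectors : ∀ {A : Set} (xs : List A) k → length (allVectors xs k) ≡ length xs ^ k
length-allVectors xs zero    = refl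
length-allVectors xs (suc k) = trans (length-cartesianProductWith _∷_ xs (allVectors xs k))
  (cong (length xs *_) (length-allVectors xs k))

∈-allVectors : ∀ {n k} (v : Vec (Fin n) k) → v ∈ₗ allVectors (allFin n) k
∈-allVectors []      = here refl
∈-allVectors (x ∷ v) = ∈-cartesianProductWith⁺ _∷_ (∈-allFin x) (∈-allVectors v)

⌈_/_⌉ : ℕ → (m : ℕ) → .{{NonZero m}} → ℕ
⌈ r / m ⌉ = (r + (m ∸ 1)) / m

≤-*-⌈/⌉ : ∀ r m .{{_ : NonZero m}} → r ≤ m * ⌈ r / m ⌉
≤-*-⌈/⌉ r (suc m) = +-cancelʳ-≤ m r _ (begin
  r + m                                     ≡⟨ m≡m%n+[m/n]*n (r + m) (suc m) ⟩
  (r + m) % suc m + ⌈ r / suc m ⌉ * suc m   ≤⟨ +-monoˡ-≤ _ (m<1+n⇒m≤n (m%n<n (r + m) (suc m))) ⟩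
  m + ⌈ r / suc m ⌉ * suc m                 ≡⟨ +-comm m _ ⟩
  ⌈ r / suc m ⌉ * suc m + m                 ≡⟨ cong (_+ m) (*-comm _ (suc m)) ⟩
  suc m * ⌈ r / suc m ⌉ + m                 ∎)
  where open ≤-Reasoning

⌈/⌉-least : ∀ {r c} m .{{_ : NonZero m}} → r ≤ m * c → ⌈ r / m ⌉ ≤ c
⌈/⌉-least {r} {c} (suc m) r≤ = m<1+n⇒m≤n (m<n*o⇒m/o<n (begin-strict
  r + m             <⟨ +-monoʳ-< r (n<1+n m) ⟩
  r + suc m         ≤⟨ +-monoˡ-≤ (suc m) r≤ ⟩
  suc m * c + suc m ≡⟨ +-comm _ (suc m) ⟩
  suc m + suc m * c ≡⟨ *-suc (suc m) c ⟨
  suc m * suc c     ≡⟨ *-comm (suc m) (suc c) ⟩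
  suc c * suc m     ∎))
  where open ≤-Reasoning

log₂-bracket : ∀ r → 0 < r → ∃ λ k → 2 ^ k ≤ r × r < 2 ^ suc k
log₂-bracket (suc zero)    _ = 0 , s≤s z≤n , s≤s (s≤s z≤n)
log₂-bracket (suc (suc r)) _ with log₂-bracket (suc r) (s≤s z≤n)
... | k , lo , hi with suc (suc r) <? 2 ^ suc k
...   | yes below = k , ≤-trans lo (n≤1+n _) , below
...   | no ¬below = suc k , ≤-reflexive 2^[1+k]≡2+r , subst (_< 2 ^ suc (suc k)) 2^[1+k]≡2+r 2^[1+k]<2^[2+k]
  where
  2^[1+k]≡2+r : 2 ^ suc k ≡ suc (suc r)
  2^[1+k]≡2+r = ≤-antisym (≮⇒≥ ¬below) hi
  2^[1+k]<2^[2+k] : 2 ^ suc k < 2 ^ suc (suc k)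
  2^[1+k]<2^[2+k] = ^-monoʳ-< 2 (s≤s (s≤s z≤n)) (n<1+n (suc k))

lookup-ext : ∀ {A : Set} {n} {xs ys : Vec A n} → (∀ i → lookup xs i ≡ lookup ys i) → xs ≡ ys
lookup-ext {xs = xs} {ys} eq = trans (sym (Vec.tabulate∘lookup xs)) (trans (Vec.tabulate-cong eq) (Vec.tabulate∘lookup ys))

lookup≡false : ∀ {n} {S : Subset n} {x} → x ∉ S → lookup S x ≡ false
lookup≡false {S = S} {x} x∉S with lookup S x in Sx
... | true  = contradiction (Vec.lookup⇒[]= x S Sx) x∉S
... | false = refl

lookup-≡ : ∀ {n} {S : Subset n} {a b} → (a ∈ S → b ∈ S) → (b ∈ S → a ∈ S) → lookup S a ≡ lookup S b
lookup-≡ {S = S} {a} {b} a⇒b b⇒a with lookup S a in Sa | lookup S b in Sb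
... | true  | true  = refl
... | false | false = refl
... | true  | false = trans (sym (Vec.[]=⇒lookup (a⇒b (Vec.lookup⇒[]= a S Sa)))) Sb
... | false | true  = trans (sym Sa) (Vec.[]=⇒lookup (b⇒a (Vec.lookup⇒[]= b S Sb)))

≢-≢⇒≡ : ∀ {a b c : Bool} → a ≢ c → b ≢ c → a ≡ b
≢-≢⇒≡ a≢c b≢c = trans (¬-not a≢c) (sym (¬-not b≢c))

¬→⇒×¬ : ∀ {a b} {A : Set a} {B : Set b} → Dec A → ¬ (A → B) → A × ¬ B
¬→⇒×¬ (yes a) ¬[A→B] = a , λ b → ¬[A→B] (λ _ → b)
¬→⇒×¬ (no ¬a) ¬[A→B] = contradiction (λ a → contradiction a ¬a) ¬[A→B]

module Canonical {n ℓ} (R : Fin n → Pred (Fin n) ℓ) (R? : ∀ x → Decidable (R x)) (R-refl : ∀ x → R x x) where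

  canon : Fin n → Fin n
  canon x = fromMaybe x (head (elements (R? x)))

  R-canon : ∀ x → R x (canon x)
  R-canon x with elements (R? x) in eq
  ... | []    = R-refl x
  ... | z ∷ _ = ∈-elements⁻ (R? x) (subst (z ∈ₗ_) (sym eq) (here refl))

  canon-cong : ∀ {x y} → R x ≐ R y → canon x ≡ canon y
  canon-cong {x} {y} Rx≐Ry with elements (R? x) in eq | ∈-elements⁺ (R? x) (R-refl x)
  ... | z ∷ _ | _ = cong (fromMaybe y ∘ head) (trans (sym eq) (filter-≐ (R? x) (R? y) Rx≐Ry (allFin n)))

^-distribʳ-* : ∀ m n o → (m * n) ^ o ≡ m ^ o * n ^ o
^-distribʳ-* m n zero    = refl
^-distribʳ-* m n (suc o) = trans (cong (m * n *_) (^-distribʳ-* m n o)) (interchange m n (m ^ o) (n ^ o))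
  where
  interchange : ∀ a b c d → a * b * (c * d) ≡ a * c * (b * d)
  interchange = solve-∀

^-*-rearrange : ∀ x a b c d → a * b ≡ c * d → (x ^ a) ^ b ≡ (x ^ c) ^ d
^-*-rearrange x a b c d eq = trans (^-*-assoc x a b) (trans (cong (x ^_) eq) (sym (^-*-assoc x c d)))

*-2^-bound : ∀ {c r} a k m → r ≤ m * k → a * 2 ^ k ≤ c → a ^ m * 2 ^ r ≤ c ^ m
*-2^-bound {c} {r} a k m r≤mk a2ᵏ≤c = begin
  a ^ m * 2 ^ r       ≤⟨ *-monoʳ-≤ (a ^ m) (^-monoʳ-≤ 2 r≤mk) ⟩
  a ^ m * 2 ^ (m * k) ≡⟨ cong (a ^ m *_) (trans (cong (2 ^_) (*-comm m k)) (sym (^-*-assoc 2 k m))) ⟩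
  a ^ m * (2 ^ k) ^ m ≡⟨ ^-distribʳ-* a (2 ^ k) m ⟨
  (a * 2 ^ k) ^ m     ≤⟨ ^-monoˡ-≤ m a2ᵏ≤c ⟩
  c ^ m               ∎
  where open ≤-Reasoning

-- log₂(X/Y) ≤ kk·k·log₂ r ≤ k·(log₂ r)², since kk ≤ log₂ r.
Log2RatioLeKSqLog2-intro : ∀ {X Y k r} kk → 2 ^ kk ≤ r → X ≤ r ^ (kk * k) * Y → Log2RatioLeKSqLog2 X Y k r
Log2RatioLeKSqLog2-intro {X} {Y} {k} {r} kk 2^kk≤r X≤ p q (s≤s _) 2ᵖYᵠ<Xᵠ s t@(suc _) _ sskq<ptt with 2 ^ s ≤? r ^ t
... | yes 2ˢ≤rᵗ = 2ˢ≤rᵗ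
... | no 2ˢ≰rᵗ = contradiction sskq<ptt (<-asym (^-cancelʳ-< 2^ptt<2^sskq))
  where
  rᵗ≤2ˢ : r ^ t ≤ 2 ^ s
  rᵗ≤2ˢ = <⇒≤ (≰⇒> 2ˢ≰rᵗ)
  ^-cancelʳ-< : ∀ {m n} → 2 ^ m < 2 ^ n → m < n
  ^-cancelʳ-< {m} {n} 2ᵐ<2ⁿ with m <? n
  ... | yes m<n = m<n
  ... | no m≮n = contradiction (^-monoʳ-≤ 2 (≮⇒≥ m≮n)) (<⇒≱ 2ᵐ<2ⁿ)
  2ᵖ<r^[kk*k*q] : 2 ^ p < r ^ (kk * k * q)
  2ᵖ<r^[kk*k*q] = *-cancelʳ-< (Y ^ q) (2 ^ p) _ (begin-strict
    2 ^ p * Y ^ q               <⟨ 2ᵖYᵠ<Xᵠ ⟩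
    X ^ q                       ≤⟨ ^-monoˡ-≤ q X≤ ⟩
    (r ^ (kk * k) * Y) ^ q      ≡⟨ ^-distribʳ-* (r ^ (kk * k)) Y q ⟩
    (r ^ (kk * k)) ^ q * Y ^ q  ≡⟨ cong (_* Y ^ q) (^-*-assoc r (kk * k) q) ⟩
    r ^ (kk * k * q) * Y ^ q    ∎)
    where open ≤-Reasoning
  2^ptt<2^sskq : 2 ^ (p * t * t) < 2 ^ (s * s * k * q)
  2^ptt<2^sskq = begin-strict
    2 ^ (p * t * t)               ≡⟨ cong (2 ^_) (*-assoc p t t) ⟩
    2 ^ (p * (t * t))             ≡⟨ ^-*-assoc 2 p (t * t) ⟨
    (2 ^ p) ^ (t * t)             <⟨ ^-monoˡ-< (t * t) 2ᵖ<r^[kk*k*q] ⟩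
    (r ^ (kk * k * q)) ^ (t * t)  ≡⟨ ^-*-rearrange r (kk * k * q) (t * t) t (kk * k * q * t) (e₁ kk k q t) ⟩
    (r ^ t) ^ (kk * k * q * t)    ≤⟨ ^-monoˡ-≤ (kk * k * q * t) rᵗ≤2ˢ ⟩
    (2 ^ s) ^ (kk * k * q * t)    ≡⟨ ^-*-rearrange 2 s (kk * k * q * t) kk (s * k * q * t) (e₂ kk k q s t) ⟩
    (2 ^ kk) ^ (s * k * q * t)    ≤⟨ ^-monoˡ-≤ (s * k * q * t) 2^kk≤r ⟩
    r ^ (s * k * q * t)           ≡⟨ cong (r ^_) (e₃ k q s t) ⟨
    r ^ (t * (s * k * q))         ≡⟨ ^-*-assoc r t (s * k * q) ⟨
    (r ^ t) ^ (s * k * q)         ≤⟨ ^-monoˡ-≤ (s * k * q) rᵗ≤2ˢ ⟩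
    (2 ^ s) ^ (s * k * q)         ≡⟨ ^-*-assoc 2 s (s * k * q) ⟩
    2 ^ (s * (s * k * q))         ≡⟨ cong (2 ^_) (e₄ k q s) ⟩
    2 ^ (s * s * k * q)           ∎
    where
    open ≤-Reasoning
    e₁ : ∀ kk k q t → kk * k * q * (t * t) ≡ t * (kk * k * q * t)
    e₁ = solve-∀
    e₂ : ∀ kk k q s t → s * (kk * k * q * t) ≡ kk * (s * k * q * t)
    e₂ = solve-∀
    e₃ : ∀ k q s t → t * (s * k * q) ≡ s * k * q * t
    e₃ = solve-∀
    e₄ : ∀ k q s → s * (s * k * q) ≡ s * s * k * q
    e₄ = solve-∀

module GroupTheory {r : ℕ} (G : FinAbGroup r) where

  open FinAbGroup G using (_∙_; ε; _⁻¹; pow)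

  abelianGroup : AbelianGroup 0ℓ 0ℓ
  abelianGroup = record { isAbelianGroup = FinAbGroup.isAbelianGroup G }

  open AbelianGroup abelianGroup public using (assoc; comm; identityˡ; identityʳ; inverseʳ)
  open AbelianGroupProperties abelianGroup public
    using (∙-cancelˡ; ∙-cancelʳ; ⁻¹-involutive; ε⁻¹≈ε; ⁻¹-∙-comm; inverseʳ-unique; identityˡ-unique; x∙y⁻¹≈ε⇒x≈y)
    renaming (\\-leftDividesˡ to x∙[x⁻¹∙y]≡y; \\-leftDividesʳ to x⁻¹∙[x∙y]≡y;
              //-rightDividesˡ to y∙x⁻¹∙x≡y; //-rightDividesʳ to y∙x∙x⁻¹≡y)
  open CommutativeSemigroupProperties (AbelianGroup.commutativeSemigroup abelianGroup) public using (interchange)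

  [y⁻¹∙x]⁻¹∙x≡y : ∀ x y → (y ⁻¹ ∙ x) ⁻¹ ∙ x ≡ y
  [y⁻¹∙x]⁻¹∙x≡y x y = begin
    (y ⁻¹ ∙ x) ⁻¹ ∙ x       ≡⟨ cong (_∙ x) (⁻¹-∙-comm (y ⁻¹) x) ⟨
    y ⁻¹ ⁻¹ ∙ x ⁻¹ ∙ x      ≡⟨ cong (λ t → t ∙ x ⁻¹ ∙ x) (⁻¹-involutive y) ⟩
    y ∙ x ⁻¹ ∙ x            ≡⟨ y∙x⁻¹∙x≡y x y ⟩
    y                       ∎
    where open ≡-Reasoning

  [x∙y⁻¹]⁻¹≡x⁻¹∙y : ∀ x y → (x ∙ y ⁻¹) ⁻¹ ≡ x ⁻¹ ∙ y
  [x∙y⁻¹]⁻¹≡x⁻¹∙y x y = trans (sym (⁻¹-∙-comm x (y ⁻¹))) (cong (x ⁻¹ ∙_) (⁻¹-involutive y))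

  [x⁻¹∙y]⁻¹≡x∙y⁻¹ : ∀ x y → (x ⁻¹ ∙ y) ⁻¹ ≡ x ∙ y ⁻¹
  [x⁻¹∙y]⁻¹≡x∙y⁻¹ x y = trans (sym (⁻¹-∙-comm (x ⁻¹) y)) (cong (_∙ y ⁻¹) (⁻¹-involutive x))

  pow-+ : ∀ x m n → pow x (m + n) ≡ pow x m ∙ pow x n
  pow-+ x zero    n = sym (identityˡ _)
  pow-+ x (suc m) n = trans (cong (x ∙_) (pow-+ x m n)) (sym (assoc _ _ _))

  pow-1 : ∀ x → pow x 1 ≡ x
  pow-1 = identityʳ

  pow-*-period : ∀ x p → pow x p ≡ ε → ∀ q → pow x (q * p) ≡ ε
  pow-*-period x p xᵖ≡ε zero    = refl
  pow-*-period x p xᵖ≡ε (suc q) = begin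
    pow x (p + q * p)           ≡⟨ pow-+ x p (q * p) ⟩
    pow x p ∙ pow x (q * p)     ≡⟨ cong₂ _∙_ xᵖ≡ε (pow-*-period x p xᵖ≡ε q) ⟩
    ε ∙ ε                       ≡⟨ identityˡ ε ⟩
    ε                           ∎
    where open ≡-Reasoning

  finite-order : ∀ x → ∃ λ p → 0 < p × p ≤ r × pow x p ≡ ε
  finite-order x with Fin.pigeonhole (n<1+n r) (λ (i : Fin (suc r)) → pow x (toℕ i))
  ... | i , j , i<j , xⁱ≡xʲ = toℕ j ∸ toℕ i , m<n⇒0<n∸m i<j , p≤r ,
        ∙-cancelˡ (pow x (toℕ i)) _ _ (begin
          pow x (toℕ i) ∙ pow x (toℕ j ∸ toℕ i) ≡⟨ pow-+ x (toℕ i) _ ⟨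
          pow x (toℕ i + (toℕ j ∸ toℕ i))       ≡⟨ cong (pow x) (m+[n∸m]≡n (<⇒≤ i<j)) ⟩
          pow x (toℕ j)                         ≡⟨ xⁱ≡xʲ ⟨
          pow x (toℕ i)                         ≡⟨ identityʳ _ ⟨
          pow x (toℕ i) ∙ ε                     ∎)
    where
    open ≡-Reasoning
    p≤r : toℕ j ∸ toℕ i ≤ r
    p≤r = ≤-trans (m∸n≤m (toℕ j) (toℕ i)) (≤-pred (Fin.toℕ<n j))

  pow-reduce : ∀ x n → ∃ λ (m : Fin r) → pow x n ≡ pow x (toℕ m)
  pow-reduce x n with finite-order x
  ... | suc p , _ , p≤r , xᵖ≡ε = fromℕ< n%p<r , (begin
      pow x n                                       ≡⟨ cong (pow x) (m≡m%n+[m/n]*n n (suc p)) ⟩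
      pow x (n % suc p + (n / suc p) * suc p)       ≡⟨ pow-+ x (n % suc p) _ ⟩
      pow x (n % suc p) ∙ pow x ((n / suc p) * suc p)
        ≡⟨ cong (pow x (n % suc p) ∙_) (pow-*-period x (suc p) xᵖ≡ε (n / suc p)) ⟩
      pow x (n % suc p) ∙ ε                         ≡⟨ identityʳ _ ⟩
      pow x (n % suc p)                             ≡⟨ cong (pow x) (Fin.toℕ-fromℕ< n%p<r) ⟨
      pow x (toℕ (fromℕ< n%p<r))                    ∎)
    where
    open ≡-Reasoning
    n%p<r : n % suc p < r
    n%p<r = <-≤-trans (m%n<n n (suc p)) p≤r

  ⁻¹-is-pow : ∀ x → ∃ λ n → x ⁻¹ ≡ pow x n
  ⁻¹-is-pow x with finite-order x
  ... | suc p , _ , _ , xᵖ≡ε = p , sym (inverseʳ-unique x (pow x p) xᵖ≡ε)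

  Periodic : Subset r → Pred (Fin r) 0ℓ
  Periodic S h = ∀ u → lookup S (h ∙ u) ≡ lookup S u

  exponent>2⇒nontrivial : ExponentGreaterThan2 G → ∃ λ y → y ≢ ε
  exponent>2⇒nontrivial exponent>2
    with Fin.¬∀⟶∃¬ r _ (λ x → pow x 1 Fin.≟ ε) (exponent>2 1 (s≤s z≤n) (s≤s z≤n))
  ... | y , y∙ε≢ε = y , λ y≡ε → y∙ε≢ε (trans (identityʳ y) y≡ε)

  Span : ∀ {n} → Vec (Fin r) n → Pred (Fin r) 0ℓ
  Span []       x = x ≡ ε
  Span (g ∷ gs) x = ∃ λ (m : Fin r) → Span gs (pow g (toℕ m) ⁻¹ ∙ x)

  span? : ∀ {n} (gs : Vec (Fin r) n) → Decidable (Span gs)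
  span? []       x = x Fin.≟ ε
  span? (g ∷ gs) x = Fin.any? (λ m → span? gs _)

  pow∙-∈-span : ∀ {n} g (gs : Vec (Fin r) n) {x} k → Span gs x → Span (g ∷ gs) (pow g k ∙ x)
  pow∙-∈-span g gs {x} k x∈ with pow-reduce g k
  ... | m , gᵏ≡gᵐ = m , subst (Span gs)
    (sym (trans (cong (λ t → t ⁻¹ ∙ (pow g k ∙ x)) (sym gᵏ≡gᵐ)) (x⁻¹∙[x∙y]≡y _ x))) x∈

  span-∷⁻ : ∀ {n} g (gs : Vec (Fin r) n) {x} → Span (g ∷ gs) x → ∃₂ λ k y → Span gs y × x ≡ pow g k ∙ y
  span-∷⁻ g gs {x} (m , y∈) = toℕ m , _ , y∈ , sym (x∙[x⁻¹∙y]≡y _ x)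

  span-weaken : ∀ {n} g (gs : Vec (Fin r) n) → Span gs ⊆ Span (g ∷ gs)
  span-weaken g gs {x} x∈ = subst (Span (g ∷ gs)) (identityˡ x) (pow∙-∈-span g gs 0 x∈)

  ε-∈-span : ∀ {n} (gs : Vec (Fin r) n) → Span gs ε
  ε-∈-span []       = refl
  ε-∈-span (g ∷ gs) = span-weaken g gs (ε-∈-span gs)

  ∈-span-∷ : ∀ {n} g (gs : Vec (Fin r) n) → Span (g ∷ gs) g
  ∈-span-∷ g gs = subst (Span (g ∷ gs)) (trans (identityʳ _) (pow-1 g)) (pow∙-∈-span g gs 1 (ε-∈-span gs))

  ∙-∈-span : ∀ {n} (gs : Vec (Fin r) n) {x y} → Span gs x → Span gs y → Span gs (x ∙ y)
  ∙-∈-span []       refl refl = identityˡ ε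
  ∙-∈-span (g ∷ gs) x∈ y∈ with span-∷⁻ g gs x∈ | span-∷⁻ g gs y∈
  ... | a , x′ , x′∈ , refl | b , y′ , y′∈ , refl =
    subst (Span (g ∷ gs)) (trans (cong (_∙ (x′ ∙ y′)) (pow-+ g a b)) (interchange _ _ _ _))
      (pow∙-∈-span g gs (a + b) (∙-∈-span gs x′∈ y′∈))

  pow-∈-span : ∀ {n} (gs : Vec (Fin r) n) {x} k → Span gs x → Span gs (pow x k)
  pow-∈-span gs zero    x∈ = ε-∈-span gs
  pow-∈-span gs (suc k) x∈ = ∙-∈-span gs x∈ (pow-∈-span gs k x∈)

  ⁻¹-∈-span : ∀ {n} (gs : Vec (Fin r) n) {x} → Span gs x → Span gs (x ⁻¹)
  ⁻¹-∈-span gs {x} x∈ with ⁻¹-is-pow x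
  ... | k , x⁻¹≡xᵏ = subst (Span gs) (sym x⁻¹≡xᵏ) (pow-∈-span gs k x∈)

  span-⁻¹ : ∀ {n} (gs : Vec (Fin r) n) {x} → Span gs (x ⁻¹) → Span gs x
  span-⁻¹ gs {x} x⁻¹∈ = subst (Span gs) (⁻¹-involutive x) (⁻¹-∈-span gs x⁻¹∈)

  span-ind : ∀ {n ℓ} (Q : Pred (Fin r) ℓ) {P : Pred (Fin r) ℓ} (gs : Vec (Fin r) n) → AllV P gs → Q ε →
    (∀ {g x} → P g → Q x → Q (g ∙ x)) → Span gs ⊆ Q
  span-ind Q []       []         Qε step refl = Qε
  span-ind Q (g ∷ gs) (Pg ∷ Pgs) Qε step {x} x∈ with span-∷⁻ g gs x∈
  ... | k , y , y∈ , refl = powers k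
    where
    powers : ∀ k → Q (pow g k ∙ y)
    powers zero    = subst Q (sym (identityˡ y)) (span-ind Q gs Pgs Qε step y∈)
    powers (suc k) = subst Q (sym (assoc _ _ _)) (step Pg (powers k))

  count-span-doubles : ∀ {n} (gs : Vec (Fin r) n) {y} → ¬ Span gs y → 2 * count (span? gs) ≤ count (span? (y ∷ gs))
  count-span-doubles gs {y} y∉ = begin
    2 * count (span? gs)                    ≡⟨ cong (count (span? gs) +_) (+-identityʳ _) ⟩
    count (span? gs) + count (span? gs)     ≤⟨ +-monoʳ-≤ (count (span? gs))
                                                (count≤-by-injection (span? gs) yspan? (y ∙_) (∙-cancelˡ y _ _) translate) ⟩
    count (span? gs) + count yspan?         ≤⟨ count-disjoint (span? gs) yspan? (span? (y ∷ gs)) disjoint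
                                                (span-weaken y gs) coset⊆ ⟩
    count (span? (y ∷ gs))                  ∎
    where
    open ≤-Reasoning
    yspan? : Decidable (λ x → Span gs (y ⁻¹ ∙ x))
    yspan? x = span? gs (y ⁻¹ ∙ x)
    translate : ∀ {x} → Span gs x → Span gs (y ⁻¹ ∙ (y ∙ x))
    translate {x} = subst (Span gs) (sym (x⁻¹∙[x∙y]≡y y x))
    disjoint : ∀ {x} → Span gs x → ¬ Span gs (y ⁻¹ ∙ x)
    disjoint {x} x∈ y⁻¹x∈ = y∉ (subst (Span gs) ([y⁻¹∙x]⁻¹∙x≡y x y) (∙-∈-span gs (⁻¹-∈-span gs y⁻¹x∈) x∈))
    coset⊆ : ∀ {x} → Span gs (y ⁻¹ ∙ x) → Span (y ∷ gs) x
    coset⊆ {x} y⁻¹x∈ = subst (Span (y ∷ gs)) (trans (cong (_∙ (y ⁻¹ ∙ x)) (pow-1 y)) (x∙[x⁻¹∙y]≡y y x))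
      (pow∙-∈-span y gs 1 y⁻¹x∈)

  module Greedy {p} {P : Pred (Fin r) p} (P? : Decidable P) where

    Missing : ∀ {n} → Vec (Fin r) n → Pred (Fin r) p
    Missing gs x = P x × ¬ Span gs x

    next : ∀ {n} (gs : Vec (Fin r) n) → Dec (∃ (Missing gs)) → Fin r
    next gs (yes (x , _)) = x
    next gs (no _)        = ε

    missing? : ∀ {n} (gs : Vec (Fin r) n) → Dec (∃ (Missing gs))
    missing? gs = Fin.any? (λ x → P? x ×-dec ¬? (span? gs x))

    generators : ∀ n → Vec (Fin r) n
    generators zero    = []
    generators (suc n) = next (generators n) (missing? (generators n)) ∷ generators n

    generators-from-P : ∀ n → AllV (λ g → P g ⊎ g ≡ ε) (generators n)
    generators-from-P zero    = []
    generators-from-P (suc n) = next-from-P (missing? (generators n)) ∷ generators-from-P n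
      where
      next-from-P : ∀ d → P (next (generators n) d) ⊎ next (generators n) d ≡ ε
      next-from-P (yes (_ , Px , _)) = inj₁ Px
      next-from-P (no _)             = inj₂ refl

    Progress : ∀ {n} → Vec (Fin r) n → Set p
    Progress {n} gs = P ⊆ Span gs ⊎ 2 ^ n ≤ count (span? gs)

    progress : ∀ n → Progress (generators n)
    progress zero    = inj₂ (count-pos (span? []) refl)
    progress (suc n) = step (missing? (generators n)) (progress n)
      where
      gs = generators n
      step : ∀ d → Progress gs → Progress (next gs d ∷ gs)
      step (yes (x , Px , x∉)) (inj₁ P⊆)  = contradiction (P⊆ Px) x∉
      step (yes (x , Px , x∉)) (inj₂ 2ⁿ≤) = inj₂ (≤-trans (*-monoʳ-≤ 2 2ⁿ≤) (count-span-doubles gs x∉))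
      step (no ∄missing)       _          = inj₁ λ {x} Px → span-weaken ε gs (spanned Px (span? gs x))
        where
        spanned : ∀ {x} → P x → Dec (Span gs x) → Span gs x
        spanned Px (yes x∈) = x∈
        spanned Px (no x∉)  = contradiction (_ , Px , x∉) ∄missing

    P⊆span : ∀ n → r < 2 ^ suc n → P ⊆ Span (generators n)
    P⊆span n r<2ⁿ⁺¹ {x} Px with progress n | span? (generators n) x
    ... | inj₁ P⊆ | _       = P⊆ Px
    ... | inj₂ _  | yes x∈ = x∈
    ... | inj₂ 2ⁿ≤ | no x∉  = contradiction (≤-trans (*-monoʳ-≤ 2 2ⁿ≤)
          (≤-trans (count-span-doubles (generators n) x∉) (count≤n (span? (x ∷ generators n))))) (<⇒≱ r<2ⁿ⁺¹)

  r≤2*count-by-translation : ∀ {Q : Pred (Fin r) 0ℓ} (Q? : Decidable Q) y → (∀ {x} → ¬ Q x → Q (y ∙ x)) →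
    r ≤ 2 * count Q?
  r≤2*count-by-translation {Q} Q? y translate = subst (_≤ 2 * count Q?) count-U (count-cover Q? τ U? covered)
    where
    τ : Fin 2 → Fin r → Fin r
    τ Fin.zero    x = x
    τ (Fin.suc _) x = y ⁻¹ ∙ x
    covered : U ⊆ Image Q? τ
    covered {x} _ with Q? x
    ... | yes Qx = Fin.zero , x , Qx , refl
    ... | no ¬Qx = Fin.suc Fin.zero , y ∙ x , translate ¬Qx , sym (x⁻¹∙[x∙y]≡y y x)

module InverseClasses {r : ℕ} (G : FinAbGroup r) where

  open FinAbGroup G using (_∙_; ε; _⁻¹)
  open GroupTheory G

  infix 4 _≡±_ _≡±?_
  _≡±_ : Fin r → Fin r → Set
  z ≡± x = z ≡ x ⊎ z ≡ x ⁻¹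

  _≡±?_ : ∀ z x → Dec (z ≡± x)
  z ≡±? x = (z Fin.≟ x) ⊎-dec (z Fin.≟ x ⁻¹)

  ≡±-sym : ∀ {x z} → z ≡± x → x ≡± z
  ≡±-sym (inj₁ refl)     = inj₁ refl
  ≡±-sym {x} (inj₂ refl) = inj₂ (sym (⁻¹-involutive x))

  ≡±-trans : ∀ {x y z} → x ≡± y → y ≡± z → x ≡± z
  ≡±-trans (inj₁ refl) y≡±z          = y≡±z
  ≡±-trans (inj₂ refl) (inj₁ refl)   = inj₂ refl
  ≡±-trans {z = z} (inj₂ refl) (inj₂ refl) = inj₁ (⁻¹-involutive z)

  ≡±-⁻¹ : ∀ x → x ⁻¹ ≡± x
  ≡±-⁻¹ x = inj₂ refl

  open Canonical (λ x z → z ≡± x) (λ x z → z ≡±? x) (λ x → inj₁ refl) public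
    renaming (canon to rep; R-canon to rep-≡±; canon-cong to rep-cong)

  IsRep : Pred (Fin r) 0ℓ
  IsRep x = x ≡ rep x

  isRep? : Decidable IsRep
  isRep? x = x Fin.≟ rep x

  rep-resp-≡± : ∀ {x y} → x ≡± y → rep x ≡ rep y
  rep-resp-≡± x≡±y = rep-cong ((λ z≡±x → ≡±-trans z≡±x x≡±y) , (λ z≡±y → ≡±-trans z≡±y (≡±-sym x≡±y)))

  rep-IsRep : ∀ x → IsRep (rep x)
  rep-IsRep x = sym (rep-resp-≡± (rep-≡± x))

  IsRep-≡± : ∀ {x y} → IsRep x → IsRep y → x ≡± y → x ≡ y
  IsRep-≡± {x} {y} x≡rx y≡ry x≡±y = trans x≡rx (trans (rep-resp-≡± x≡±y) (sym y≡ry))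

  count≤2*count-reps : ∀ {D : Pred (Fin r) 0ℓ} (D? : Decidable D) → (∀ {x} → D x → D (x ⁻¹)) →
    count D? ≤ 2 * count (D? ∩? isRep?)
  count≤2*count-reps {D} D? D-⁻¹ = count-cover (D? ∩? isRep?) ±id D? covered
    where
    ±id : Fin 2 → Fin r → Fin r
    ±id Fin.zero    x = x
    ±id (Fin.suc _) x = x ⁻¹
    D-≡± : ∀ {x y} → y ≡± x → D x → D y
    D-≡± (inj₁ refl) Dx = Dx
    D-≡± (inj₂ refl) Dx = D-⁻¹ Dx
    covered : D ⊆ Image (D? ∩? isRep?) ±id
    covered {x} Dx with ≡±-sym (rep-≡± x)
    ... | inj₁ x≡rx = Fin.zero , rep x , (D-≡± (rep-≡± x) Dx , rep-IsRep x) , x≡rx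
    ... | inj₂ x≡rx⁻¹ = Fin.suc Fin.zero , rep x , (D-≡± (rep-≡± x) Dx , rep-IsRep x) , x≡rx⁻¹

  ⌈r/4⌉≤count-reps : ∀ {Q : Pred (Fin r) 0ℓ} (Q? : Decidable Q) → (∀ {x} → Q x → Q (x ⁻¹)) →
    r ≤ 2 * count Q? → ⌈ r / 4 ⌉ ≤ count (Q? ∩? isRep?)
  ⌈r/4⌉≤count-reps Q? Q-⁻¹ r≤ = ⌈/⌉-least 4 (≤-trans r≤ (≤-trans (*-monoʳ-≤ 2 (count≤2*count-reps Q? Q-⁻¹))
    (≤-reflexive (sym (*-assoc 2 2 (count (Q? ∩? isRep?)))))))

  lookup-⁻¹ : ∀ {S : Subset r} → InvClosed G S → ∀ x → lookup S (x ⁻¹) ≡ lookup S x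
  lookup-⁻¹ {S} S-inv x = lookup-≡ (λ x⁻¹∈S → subst (_∈ S) (⁻¹-involutive x) (S-inv (x ⁻¹) x⁻¹∈S)) (S-inv x)

  InvClosed-lookup : ∀ {S : Subset r} → (∀ x → lookup S (x ⁻¹) ≡ lookup S x) → InvClosed G S
  InvClosed-lookup {S} S-inv x x∈S = Vec.lookup⇒[]= (x ⁻¹) S (trans (S-inv x) (Vec.[]=⇒lookup x∈S))

module Compression {r : ℕ} (G : FinAbGroup r)
  {C : Set} (codes : List C) (code : Subset r → C) (code∈ : ∀ S → code S ∈ₗ codes)
  (Open : C → Pred (Fin r) 0ℓ) (open? : ∀ c → Decidable (Open c))
  (Open-⁻¹ : ∀ c {x} → Open c x → Open c (FinAbGroup._⁻¹ G x))
  (k : ℕ) {L : List (Subset r)} (L-unique : Unique L) (L-inv : ∀ {S} → S ∈ₗ L → InvClosed G S)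
  (enough : ∀ {S} → S ∈ₗ L → k ≤ count (open? (code S) ∩? InverseClasses.isRep? G))
  (determined : ∀ {S T} → S ∈ₗ L → T ∈ₗ L → code S ≡ code T →
                (∀ x → ¬ Open (code S) x → lookup S x ≡ lookup T x) → S ≡ T)
  where

  open FinAbGroup G using (_∙_; ε; _⁻¹)
  open GroupTheory G
  open InverseClasses G

  free : C → Fin k → Fin r
  free c = enumerate (open? c ∩? isRep?) ε k

  Slot : C → Fin r → Set
  Slot c x = ∃ λ i → free c i ≡± x

  slot? : ∀ c x → Dec (Slot c x)
  slot? c x = Fin.any? (λ i → free c i ≡±? x)

  slotWith : ∀ {c x} → Dec (Slot c x) → Maybe (Fin k)
  slotWith (yes (i , _)) = just i
  slotWith (no _)        = nothing

  fill : C → Subset k → Subset r → Fin r → Bool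
  fill c β S x = maybe (lookup β) (lookup S x) (slotWith (slot? c x))

  module _ {S : Subset r} (S∈L : S ∈ₗ L) where

    private
      c = code S

    free-injective : ∀ i j → free c i ≡ free c j → i ≡ j
    free-injective = enumerate-injective (open? c ∩? isRep?) ε k (enough S∈L)

    free-open : ∀ i → Open c (free c i)
    free-open i = proj₁ (enumerate-∈ (open? c ∩? isRep?) ε k (enough S∈L) i)

    free-IsRep : ∀ i → IsRep (free c i)
    free-IsRep i = proj₂ (enumerate-∈ (open? c ∩? isRep?) ε k (enough S∈L) i)

    open-≡± : ∀ {x y} → y ≡± x → Open c x → Open c y
    open-≡± (inj₁ refl) = λ o → o
    open-≡± (inj₂ refl) = Open-⁻¹ c

    slot-unique : ∀ {i j x} → free c i ≡± x → free c j ≡± x → i ≡ j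
    slot-unique {i} {j} p q = free-injective i j (IsRep-≡± (free-IsRep i) (free-IsRep j) (≡±-trans p (≡±-sym q)))

    slot-⁻¹ : ∀ x (d : Dec (Slot c (x ⁻¹))) (e : Dec (Slot c x)) → slotWith d ≡ slotWith e
    slot-⁻¹ x (yes (i , p)) (yes (j , q)) = cong just (slot-unique (≡±-trans p (≡±-⁻¹ x)) q)
    slot-⁻¹ x (yes (i , p)) (no ¬q)       = contradiction (i , ≡±-trans p (≡±-⁻¹ x)) ¬q
    slot-⁻¹ x (no ¬p)       (yes (j , q)) = contradiction (j , ≡±-trans q (≡±-sym (≡±-⁻¹ x))) ¬p
    slot-⁻¹ x (no _)        (no _)        = refl

    fill-⁻¹ : ∀ β x → fill c β S (x ⁻¹) ≡ fill c β S x
    fill-⁻¹ β x with slotWith (slot? c (x ⁻¹)) | slotWith (slot? c x) | slot-⁻¹ x (slot? c (x ⁻¹)) (slot? c x)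
    ... | just i  | .(just i) | refl = refl
    ... | nothing | .nothing  | refl = lookup-⁻¹ (L-inv S∈L) x

    fill-free : ∀ β i → fill c β S (free c i) ≡ lookup β i
    fill-free β i with slot? c (free c i)
    ... | yes (j , p) = cong (lookup β) (slot-unique p (inj₁ refl))
    ... | no ¬p       = contradiction (i , inj₁ refl) ¬p

    fill-closed : ∀ β {x} → ¬ Open c x → fill c β S x ≡ lookup S x
    fill-closed β {x} ¬open with slot? c x
    ... | yes (i , i≡±x) = contradiction (open-≡± (≡±-sym i≡±x) (free-open i)) ¬open
    ... | no _                = refl

  -- The code of S determines the free positions, so the image determines β; outside the free
  -- pairs the image agrees with S, in particular at every closed position.
  compress : Subset r × Subset k → C × Subset r
  compress (S , β) = code S , tabulate (fill (code S) β S)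

  compression : length L * 2 ^ k ≤ length codes * numInvClosed G
  compression = subst₂ _≤_
    (trans (length-cartesianProductWith _,_ L (allSubsets k)) (cong (length L *_) (length-allSubsets k)))
    (length-cartesianProductWith _,_ codes (filter (invClosed? G) (allSubsets r)))
    (length≤-by-injection compress _ (Unique.cartesianProduct⁺ L-unique (allSubsets-unique k)) maps inj)
    where
    maps : ∀ {p} → p ∈ₗ cartesianProduct L (allSubsets k) →
           compress p ∈ₗ cartesianProduct codes (filter (invClosed? G) (allSubsets r))
    maps {S , β} p∈ with ∈-cartesianProduct⁻ L (allSubsets k) p∈
    ... | S∈L , _ = ∈-cartesianProduct⁺ (code∈ S) (∈-filter⁺ (invClosed? G) (∈-allSubsets _)
          (InvClosed-lookup λ x → trans (Vec.lookup∘tabulate _ (x ⁻¹))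
            (trans (fill-⁻¹ S∈L β x) (sym (Vec.lookup∘tabulate _ x)))))

    inj : ∀ {p q} → p ∈ₗ cartesianProduct L (allSubsets k) → q ∈ₗ cartesianProduct L (allSubsets k) →
          compress p ≡ compress q → p ≡ q
    inj {S , β} {T , γ} p∈ q∈ eq
      with ∈-cartesianProduct⁻ L (allSubsets k) p∈ | ∈-cartesianProduct⁻ L (allSubsets k) q∈
    ... | S∈L , _ | T∈L , _ = cong₂ _,_ S≡T β≡γ
      where
      same-code : code S ≡ code T
      same-code = cong proj₁ eq
      same-fill : ∀ x → fill (code S) β S x ≡ fill (code T) γ T x
      same-fill x = trans (sym (Vec.lookup∘tabulate _ x))
        (trans (cong (λ v → lookup (proj₂ v) x) eq) (Vec.lookup∘tabulate _ x))
      β≡γ : β ≡ γ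
      β≡γ = lookup-ext λ i → begin
        lookup β i                         ≡⟨ fill-free S∈L β i ⟨
        fill (code S) β S (free (code S) i) ≡⟨ same-fill _ ⟩
        fill (code T) γ T (free (code S) i) ≡⟨ cong (λ c → fill (code T) γ T (free c i)) same-code ⟩
        fill (code T) γ T (free (code T) i) ≡⟨ fill-free T∈L γ i ⟩
        lookup γ i                         ∎
        where open ≡-Reasoning
      S≡T : S ≡ T
      S≡T = determined S∈L T∈L same-code λ x ¬open → begin
        lookup S x              ≡⟨ fill-closed S∈L β ¬open ⟨
        fill (code S) β S x     ≡⟨ same-fill x ⟩
        fill (code T) γ T x     ≡⟨ fill-closed T∈L γ (subst (λ c → ¬ Open c x) same-code ¬open) ⟩
        lookup T x              ∎
        where open ≡-Reasoning

module CayleyGraph {r : ℕ} (G : FinAbGroup r) (S : Subset r) where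

  open FinAbGroup G using (_∙_; ε; _⁻¹)
  open GroupTheory G

  Adj-∙ʳ : ∀ z {x y} → Adj G S x y → Adj G S (x ∙ z) (y ∙ z)
  Adj-∙ʳ z {x} {y} = subst (_∈ S) (sym (begin
    (y ∙ z) ∙ (x ∙ z) ⁻¹     ≡⟨ cong ((y ∙ z) ∙_) (⁻¹-∙-comm x z) ⟨
    (y ∙ z) ∙ (x ⁻¹ ∙ z ⁻¹)  ≡⟨ interchange y z (x ⁻¹) (z ⁻¹) ⟩
    (y ∙ x ⁻¹) ∙ (z ∙ z ⁻¹)  ≡⟨ cong ((y ∙ x ⁻¹) ∙_) (inverseʳ z) ⟩
    (y ∙ x ⁻¹) ∙ ε           ≡⟨ identityʳ _ ⟩
    y ∙ x ⁻¹                 ∎))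
    where open ≡-Reasoning

  Adj-∙ˡ : ∀ z {x y} → Adj G S x y → Adj G S (z ∙ x) (z ∙ y)
  Adj-∙ˡ z {x} {y} a = subst₂ (Adj G S) (comm x z) (comm y z) (Adj-∙ʳ z a)

  connected-from-ε : (∀ y → Star (Adj G S) ε y) → Connected G S
  connected-from-ε reach x y = subst₂ (Star (Adj G S)) (identityˡ x) (y∙x⁻¹∙x≡y x y)
    (gmap (_∙ x) (Adj-∙ʳ x) (reach (y ∙ x ⁻¹)))

  span-reachable : ∀ {n} (gs : Vec (Fin r) n) → AllV (λ g → g ∈ S ⊎ g ≡ ε) gs → Span gs ⊆ Star (Adj G S) ε
  span-reachable gs gs⊆S = span-ind (Star (Adj G S) ε) gs gs⊆S [] step
    where
    step : ∀ {g x} → g ∈ S ⊎ g ≡ ε → Star (Adj G S) ε x → Star (Adj G S) ε (g ∙ x)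
    step {g} {x} (inj₁ g∈S) walk = walk ◅◅ (subst (_∈ S) (sym (y∙x∙x⁻¹≡y x g)) g∈S ◅ [])
    step {g} {x} (inj₂ refl) walk = subst (Star (Adj G S) ε) (sym (identityˡ x)) walk

module Colouring {r : ℕ} (G : FinAbGroup r) (S : Subset r) where

  open FinAbGroup G using (_∙_; ε; _⁻¹)
  open GroupTheory G

  Proper : (Fin r → Bool) → Set
  Proper c = ∀ x y → Adj G S x y → c x ≢ c y

  proper? : ∀ c → Dec (Proper c)
  proper? c = Fin.all? λ x → Fin.all? λ y → (_ ∈? S) →-dec ¬? (c x ≟ᵇ c y)

  agree-along : ∀ {c c′} → Proper c → Proper c′ → ∀ {u v} → Star (Adj G S) u v → c u ≡ c′ u → c v ≡ c′ v
  agree-along pc pc′ []           eq = eq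
  agree-along {c} {c′} pc pc′ {u} (a ◅ walk) eq = agree-along pc pc′ walk (begin
    c _        ≡⟨ ¬-not (λ eq′ → pc _ _ a (sym eq′)) ⟩
    not (c u)  ≡⟨ cong not eq ⟩
    not (c′ u) ≡⟨ ¬-not (λ eq′ → pc′ _ _ a (sym eq′)) ⟨
    c′ _       ∎)
    where open ≡-Reasoning

  module _ (connected : Connected G S) {c : Fin r → Bool} (proper : Proper c) where

    translate-proper : ∀ g → Proper (λ x → c (g ∙ x))
    translate-proper g x y a = proper _ _ (CayleyGraph.Adj-∙ˡ G S g a)

    -- x ↦ g ∙ x is a graph automorphism, and two proper colourings of a connected graph agree
    -- everywhere or nowhere.
    translate-colour : ∀ g x → c g ≡ c ε → c (g ∙ x) ≡ c x
    translate-colour g x cg≡cε = sym (agree-along proper (translate-proper g) (connected ε x)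
      (sym (trans (cong c (identityʳ g)) cg≡cε)))

    translate-colour⁻ : ∀ g x → c (g ∙ x) ≡ c x → c g ≡ c ε
    translate-colour⁻ g x eq = trans (cong c (sym (identityʳ g)))
      (sym (agree-along proper (translate-proper g) (connected x ε) (sym eq)))

  -- The code of S must depend on S alone, so the colouring is found by search instead of
  -- being taken from a Bipartite witness.
  chosen : Dec (Any (Proper ∘ lookup) (allSubsets r)) → Subset r
  chosen (yes found) = proj₁ (Any.satisfied found)
  chosen (no _)      = replicate r false

  colouring : Fin r → Bool
  colouring = lookup (chosen (Any.any? (proper? ∘ lookup) (allSubsets r)))

  colouring-proper : Bipartite G S → Proper colouring
  colouring-proper (c , pc) = chosen-proper (Any.any? (proper? ∘ lookup) (allSubsets r))
    where
    chosen-proper : ∀ d → Proper (lookup (chosen d))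
    chosen-proper (yes found) = proj₂ (Any.satisfied found)
    chosen-proper (no none)   = contradiction
      (Any.map (λ { refl x y a eq → pc x y a (trans (sym (Vec.lookup∘tabulate c x)) (trans eq (Vec.lookup∘tabulate c y))) })
        (∈-allSubsets (tabulate c)))
      none

module Disconnected {r : ℕ} (G : FinAbGroup r) (kk : ℕ) (r<2^[1+kk] : r < 2 ^ suc kk) where

  open FinAbGroup G using (_∙_; ε; _⁻¹)
  open GroupTheory G
  open InverseClasses G

  generatorsOf : Subset r → Vec (Fin r) kk
  generatorsOf S = Greedy.generators (_∈? S) kk

  Outside : Vec (Fin r) kk → Pred (Fin r) 0ℓ
  Outside c = ∁ (Span c)

  outside? : ∀ c → Decidable (Outside c)
  outside? c = ∁? (span? c)

  module _ {S : Subset r} (disconnected : ¬ Connected G S) where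

    private
      c = generatorsOf S

    S⊆span : (_∈ S) ⊆ Span c
    S⊆span = Greedy.P⊆span (_∈? S) kk r<2^[1+kk]

    span-proper : ∃ (Outside c)
    span-proper = Fin.¬∀⟶∃¬ r (Span c) (span? c) λ all∈ →
      disconnected (CayleyGraph.connected-from-ε G S λ y →
        CayleyGraph.span-reachable G S c (Greedy.generators-from-P (_∈? S) kk) (all∈ y))

    enough-outside : ⌈ r / 4 ⌉ ≤ count (outside? c ∩? isRep?)
    enough-outside = ⌈r/4⌉≤count-reps (outside? c) (λ x∉ x⁻¹∈ → x∉ (span-⁻¹ c x⁻¹∈))
      (r≤2*count-by-translation (outside? c) y λ {x} x∈ yx∈ →
        y∉ (subst (Span c) (y∙x∙x⁻¹≡y x y) (∙-∈-span c yx∈ (⁻¹-∈-span c (decidable-stable (span? c x) x∈)))))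
      where
      y = proj₁ span-proper
      y∉ = proj₂ span-proper

  count-disconnected : ∀ {L} → Unique L → All (λ S → InvClosed G S × ¬ Connected G S) L →
    length L * 2 ^ ⌈ r / 4 ⌉ ≤ r ^ kk * numInvClosed G
  count-disconnected {L} L-unique hL = subst (λ n → length L * 2 ^ ⌈ r / 4 ⌉ ≤ n * numInvClosed G)
    (trans (length-allVectors (allFin r) kk) (cong (_^ kk) (length-allFin r)))
    (Compression.compression G (allVectors (allFin r) kk) generatorsOf (λ S → ∈-allVectors (generatorsOf S))
      Outside outside? (λ c x∉ x⁻¹∈ → x∉ (span-⁻¹ c x⁻¹∈)) ⌈ r / 4 ⌉ L-unique
      (λ S∈L → proj₁ (All.lookup hL S∈L)) (λ S∈L → enough-outside (proj₂ (All.lookup hL S∈L))) determined)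
    where
    determined : ∀ {S T} → S ∈ₗ L → T ∈ₗ L → generatorsOf S ≡ generatorsOf T →
      (∀ x → ¬ Outside (generatorsOf S) x → lookup S x ≡ lookup T x) → S ≡ T
    determined {S} {T} S∈L T∈L same agree = lookup-ext λ x → case (span? (generatorsOf S) x)
      where
      case : ∀ {x} → Dec (Span (generatorsOf S) x) → lookup S x ≡ lookup T x
      case {x} (yes x∈) = agree x (λ x∉ → x∉ x∈)
      case {x} (no x∉) = trans (lookup≡false (λ x∈S → x∉ (S⊆span (proj₂ (All.lookup hL S∈L)) x∈S)))
        (sym (lookup≡false (λ x∈T → x∉ (subst (λ c → Span c x) (sym same) (S⊆span (proj₂ (All.lookup hL T∈L)) x∈T)))))

module ConnectedBipartite {r : ℕ} (G : FinAbGroup r) (nontrivial : ∃ λ y → y ≢ FinAbGroup.ε G)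
  (kk : ℕ) (r<2^[1+kk] : r < 2 ^ suc kk) where

  open FinAbGroup G using (_∙_; ε; _⁻¹)
  open GroupTheory G
  open InverseClasses G

  Even : Subset r → Pred (Fin r) 0ℓ
  Even S x = Colouring.colouring G S x ≡ Colouring.colouring G S ε

  even? : ∀ S → Decidable (Even S)
  even? S x = _ ≟ᵇ _

  generatorsOf : Subset r → Vec (Fin r) kk
  generatorsOf S = Greedy.generators (even? S) kk

  module _ {S : Subset r} (connected : Connected G S) (bipartite : Bipartite G S) where

    private
      c = Colouring.colouring G S
      proper = Colouring.colouring-proper G S bipartite
      gens = generatorsOf S

    even⊆span : Even S ⊆ Span gens
    even⊆span = Greedy.P⊆span (even? S) kk r<2^[1+kk]

    span⊆even : Span gens ⊆ Even S
    span⊆even = span-ind (Even S) gens (Greedy.generators-from-P (even? S) kk) refl step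
      where
      step : ∀ {g x} → Even S g ⊎ g ≡ ε → Even S x → Even S (g ∙ x)
      step {g} {x} (inj₁ even-g) even-x = trans (Colouring.translate-colour G S connected proper g x even-g) even-x
      step {g} {x} (inj₂ refl)   even-x = trans (cong c (identityˡ x)) even-x

    odd : ∀ {s} → s ∈ S → ¬ Even S s
    odd {s} s∈S even-s = proper ε s (subst (_∈ S) (sym s∙ε⁻¹≡s) s∈S) (sym even-s)
      where
      s∙ε⁻¹≡s : s ∙ ε ⁻¹ ≡ s
      s∙ε⁻¹≡s = trans (cong (s ∙_) ε⁻¹≈ε) (identityʳ s)

    element : ∃ (_∈ S)
    element = first-step (proj₂ nontrivial) (connected ε (proj₁ nontrivial))
      where
      first-step : ∀ {y} → y ≢ ε → Star (Adj G S) ε y → ∃ (_∈ S)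
      first-step y≢ε []                    = contradiction refl y≢ε
      first-step _   (_◅_ {j = z} ε~z _) = z , subst (_∈ S) (trans (cong (z ∙_) ε⁻¹≈ε) (identityʳ z)) ε~z

    enough-span : ⌈ r / 4 ⌉ ≤ count (span? gens ∩? isRep?)
    enough-span = ⌈r/4⌉≤count-reps (span? gens) (⁻¹-∈-span gens)
      (r≤2*count-by-translation (span? gens) s λ {x} x∉ → even⊆span
        (≢-≢⇒≡ (λ eq → odd s∈S (Colouring.translate-colour⁻ G S connected proper s x eq))
               (λ eq → x∉ (even⊆span (sym eq)))))
      where
      s = proj₁ element
      s∈S = proj₂ element

  count-bipartite : ∀ {L} → Unique L → All (λ S → InvClosed G S × Connected G S × Bipartite G S) L →
    length L * 2 ^ ⌈ r / 4 ⌉ ≤ r ^ kk * numInvClosed G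
  count-bipartite {L} L-unique hL = subst (λ n → length L * 2 ^ ⌈ r / 4 ⌉ ≤ n * numInvClosed G)
    (trans (length-allVectors (allFin r) kk) (cong (_^ kk) (length-allFin r)))
    (Compression.compression G (allVectors (allFin r) kk) generatorsOf (λ S → ∈-allVectors (generatorsOf S))
      Span span? ⁻¹-∈-span ⌈ r / 4 ⌉ L-unique
      (λ S∈L → proj₁ (All.lookup hL S∈L)) (λ S∈L → enough-span (conn S∈L) (bip S∈L)) determined)
    where
    conn : ∀ {S} → S ∈ₗ L → Connected G S
    conn S∈L = proj₁ (proj₂ (All.lookup hL S∈L))
    bip : ∀ {S} → S ∈ₗ L → Bipartite G S
    bip S∈L = proj₂ (proj₂ (All.lookup hL S∈L))
    ∉S : ∀ {S} → S ∈ₗ L → ∀ {x} → Span (generatorsOf S) x → lookup S x ≡ false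
    ∉S S∈L x∈ = lookup≡false (λ x∈S → odd (conn S∈L) (bip S∈L) x∈S (span⊆even (conn S∈L) (bip S∈L) x∈))
    determined : ∀ {S T} → S ∈ₗ L → T ∈ₗ L → generatorsOf S ≡ generatorsOf T →
      (∀ x → ¬ Span (generatorsOf S) x → lookup S x ≡ lookup T x) → S ≡ T
    determined {S} {T} S∈L T∈L same agree = lookup-ext λ x → case (span? (generatorsOf S) x)
      where
      case : ∀ {x} → Dec (Span (generatorsOf S) x) → lookup S x ≡ lookup T x
      case {x} (yes x∈) = trans (∉S S∈L x∈) (sym (∉S T∈L (subst (λ c → Span c x) same x∈)))
      case {x} (no x∉)  = agree x x∉

module Orbits {r : ℕ} (G : FinAbGroup r) (h : Fin r) where

  open FinAbGroup G using (_∙_; ε; _⁻¹)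
  open GroupTheory G
  open InverseClasses G

  ⟨h⟩ : Pred (Fin r) 0ℓ
  ⟨h⟩ = Span (h ∷ [])

  Orbit : Fin r → Pred (Fin r) 0ℓ
  Orbit x z = ∃ λ a → ⟨h⟩ a × z ≡± a ∙ x

  orbit? : ∀ x → Decidable (Orbit x)
  orbit? x z = Fin.any? λ a → span? (h ∷ []) a ×-dec (z ≡±? a ∙ x)

  orbit-refl : ∀ x → Orbit x x
  orbit-refl x = ε , ε-∈-span (h ∷ []) , inj₁ (sym (identityˡ x))

  orbit-≡± : ∀ {x y} → y ≡± x → Orbit x y
  orbit-≡± (inj₁ refl) = orbit-refl _
  orbit-≡± {x} (inj₂ refl) = ε , ε-∈-span (h ∷ []) , inj₂ (cong _⁻¹ (sym (identityˡ x)))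

  orbit-sym : ∀ {x z} → Orbit x z → Orbit z x
  orbit-sym {x} (a , a∈ , inj₁ refl) = a ⁻¹ , ⁻¹-∈-span (h ∷ []) a∈ , inj₁ (sym (x⁻¹∙[x∙y]≡y a x))
  orbit-sym {x} (a , a∈ , inj₂ refl) = a , a∈ , inj₂ (begin
    x                      ≡⟨ x⁻¹∙[x∙y]≡y a x ⟨
    a ⁻¹ ∙ (a ∙ x)         ≡⟨ cong (a ⁻¹ ∙_) (⁻¹-involutive (a ∙ x)) ⟨
    a ⁻¹ ∙ (a ∙ x) ⁻¹ ⁻¹   ≡⟨ ⁻¹-∙-comm a ((a ∙ x) ⁻¹) ⟩
    (a ∙ (a ∙ x) ⁻¹) ⁻¹    ∎)
    where open ≡-Reasoning

  orbit-trans : ∀ {x y z} → Orbit x y → Orbit y z → Orbit x z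
  orbit-trans {x} (a , a∈ , inj₁ refl) (b , b∈ , inj₁ refl) =
    b ∙ a , ∙-∈-span (h ∷ []) b∈ a∈ , inj₁ (sym (assoc b a x))
  orbit-trans {x} (a , a∈ , inj₁ refl) (b , b∈ , inj₂ refl) =
    b ∙ a , ∙-∈-span (h ∷ []) b∈ a∈ , inj₂ (cong _⁻¹ (sym (assoc b a x)))
  orbit-trans {x} (a , a∈ , inj₂ refl) (b , b∈ , inj₁ refl) =
    b ⁻¹ ∙ a , ∙-∈-span (h ∷ []) (⁻¹-∈-span (h ∷ []) b∈) a∈ ,
    inj₂ (sym (trans (cong _⁻¹ (assoc (b ⁻¹) a x)) ([x⁻¹∙y]⁻¹≡x∙y⁻¹ b (a ∙ x))))
  orbit-trans {x} (a , a∈ , inj₂ refl) (b , b∈ , inj₂ refl) =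
    b ⁻¹ ∙ a , ∙-∈-span (h ∷ []) (⁻¹-∈-span (h ∷ []) b∈) a∈ ,
    inj₁ (trans ([x∙y⁻¹]⁻¹≡x⁻¹∙y b (a ∙ x)) (sym (assoc (b ⁻¹) a x)))

  open Canonical Orbit orbit? orbit-refl public
    renaming (canon to orbitRep; R-canon to orbit-orbitRep; canon-cong to orbitRep-cong)

  orbitRep-resp : ∀ {x z} → Orbit x z → orbitRep z ≡ orbitRep x
  orbitRep-resp x~z = orbitRep-cong ((λ z~w → orbit-trans x~z z~w) , (λ x~w → orbit-trans (orbit-sym x~z) x~w))

  Canonical : Pred (Fin r) 0ℓ
  Canonical x = x ≡± orbitRep x

  canonical? : Decidable Canonical
  canonical? x = x ≡±? orbitRep x

  Canonical-≡± : ∀ {x y} → y ≡± x → Canonical x → Canonical y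
  Canonical-≡± {x} {y} y≡±x x≡±b = subst (y ≡±_) (sym (orbitRep-resp (orbit-≡± y≡±x))) (≡±-trans y≡±x x≡±b)

  Canonical-orbitRep : ∀ x → Canonical (orbitRep x)
  Canonical-orbitRep x = inj₁ (sym (orbitRep-resp (orbit-orbitRep x)))

  translate-canonical : ∀ {g x} → ⟨h⟩ g → g ≢ ε → Canonical x → Canonical (g ∙ x) → g ∙ x ≡ x ⁻¹
  translate-canonical {g} {x} g∈ g≢ε x≡±b gx≡±b′
    with ≡±-trans gx≡±b′ (subst (_≡± x) (sym (orbitRep-resp (g , g∈ , inj₁ refl))) (≡±-sym x≡±b))
  ... | inj₁ gx≡x   = contradiction (identityˡ-unique g x gx≡x) g≢ε
  ... | inj₂ gx≡x⁻¹ = gx≡x⁻¹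

  free? : Decidable (∁ Canonical ∩ IsRep)
  free? = ∁? canonical? ∩? isRep?

  SelfInverse : Pred (Fin r) 0ℓ
  SelfInverse x = x ≡ x ⁻¹

  selfInverse? : Decidable SelfInverse
  selfInverse? x = x Fin.≟ x ⁻¹

  SelfInverse-IsRep : ∀ {x} → SelfInverse x → IsRep x
  SelfInverse-IsRep {x} x≡x⁻¹ with rep-≡± x
  ... | inj₁ rx≡x   = sym rx≡x
  ... | inj₂ rx≡x⁻¹ = trans x≡x⁻¹ (sym rx≡x⁻¹)

  count-nonCanonical≤2*count-free : count (∁? canonical?) ≤ 2 * count free?
  count-nonCanonical≤2*count-free = count≤2*count-reps (∁? canonical?)
    λ {x} ¬cx cx⁻¹ → ¬cx (Canonical-≡± (≡±-sym (≡±-⁻¹ x)) cx⁻¹)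

  module _ (h≢ε : h ≢ ε) where

    h∈⟨h⟩ : ⟨h⟩ h
    h∈⟨h⟩ = ∈-span-∷ h []

    h⁻¹≢ε : h ⁻¹ ≢ ε
    h⁻¹≢ε h⁻¹≡ε = h≢ε (trans (sym (⁻¹-involutive h)) (trans (cong _⁻¹ h⁻¹≡ε) ε⁻¹≈ε))

    r≤3*count-nonCanonical : h ≢ h ⁻¹ → r ≤ 3 * count (∁? canonical?)
    r≤3*count-nonCanonical h≢h⁻¹ =
      subst (_≤ 3 * count (∁? canonical?)) count-U (count-cover (∁? canonical?) τ U? covered)
      where
      τ : Fin 3 → Fin r → Fin r
      τ Fin.zero                   x = x
      τ (Fin.suc Fin.zero)         x = h ⁻¹ ∙ x
      τ (Fin.suc (Fin.suc Fin.zero)) x = h ∙ x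
      covered : U ⊆ Image (∁? canonical?) τ
      covered {x} _ with canonical? x | canonical? (h ∙ x) | canonical? (h ⁻¹ ∙ x)
      ... | no ¬cx | _ | _ = Fin.zero , x , ¬cx , refl
      ... | yes _ | no ¬chx | _ = Fin.suc Fin.zero , h ∙ x , ¬chx , sym (x⁻¹∙[x∙y]≡y h x)
      ... | yes _ | yes _ | no ¬ch⁻¹x = Fin.suc (Fin.suc Fin.zero) , h ⁻¹ ∙ x , ¬ch⁻¹x , sym (x∙[x⁻¹∙y]≡y h x)
      ... | yes cx | yes chx | yes ch⁻¹x = contradiction (∙-cancelʳ x h (h ⁻¹) (trans
            (translate-canonical h∈⟨h⟩ h≢ε cx chx)
            (sym (translate-canonical (⁻¹-∈-span (h ∷ []) h∈⟨h⟩) h⁻¹≢ε cx ch⁻¹x)))) h≢h⁻¹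

    module _ (h≡h⁻¹ : h ≡ h ⁻¹) where

      Flipped : Pred (Fin r) 0ℓ
      Flipped x = h ∙ x ≡ x ⁻¹

      flipped? : Decidable Flipped
      flipped? x = h ∙ x Fin.≟ x ⁻¹

      h∙h≡ε : h ∙ h ≡ ε
      h∙h≡ε = trans (cong (h ∙_) h≡h⁻¹) (inverseʳ h)

      r≤2*count-nonCanonical+count-flipped : r ≤ 2 * count (∁? canonical?) + count flipped?
      r≤2*count-nonCanonical+count-flipped = subst (_≤ 2 * count (∁? canonical?) + count flipped?) count-U
        (count-cover∪ (∁? canonical?) τ U? flipped? covered)
        where
        τ : Fin 2 → Fin r → Fin r
        τ Fin.zero    x = x
        τ (Fin.suc _) x = h ∙ x
        covered : ∀ {x} → U x → Flipped x ⊎ Image (∁? canonical?) τ x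
        covered {x} _ with canonical? x | canonical? (h ∙ x)
        ... | no ¬cx | _      = inj₂ (Fin.zero , x , ¬cx , refl)
        ... | yes _  | no ¬chx = inj₂ (Fin.suc Fin.zero , h ∙ x , ¬chx ,
                                  sym (trans (sym (assoc h h x)) (trans (cong (_∙ x) h∙h≡ε) (identityˡ x))))
        ... | yes cx | yes chx = inj₁ (translate-canonical h∈⟨h⟩ h≢ε cx chx)

      count-flipped≤count-selfInverse : count flipped? ≤ count selfInverse?
      count-flipped≤count-selfInverse with Fin.any? flipped?
      ... | no none = subst (_≤ count selfInverse?) (sym (count-none flipped? λ x flipped → none (x , flipped))) z≤n
      ... | yes (x₀ , flipped₀) =
        count≤-by-injection flipped? selfInverse? (x₀ ⁻¹ ∙_) (∙-cancelˡ (x₀ ⁻¹) _ _) λ {x} flipped → begin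
          x₀ ⁻¹ ∙ x         ≡⟨ cong (_∙ x) flipped₀ ⟨
          h ∙ x₀ ∙ x        ≡⟨ cong (_∙ x) (comm h x₀) ⟩
          x₀ ∙ h ∙ x        ≡⟨ assoc x₀ h x ⟩
          x₀ ∙ (h ∙ x)      ≡⟨ cong (x₀ ∙_) flipped ⟩
          x₀ ∙ x ⁻¹         ≡⟨ [x⁻¹∙y]⁻¹≡x∙y⁻¹ x₀ x ⟨
          (x₀ ⁻¹ ∙ x) ⁻¹    ∎
        where open ≡-Reasoning

      count-selfInverse : count selfInverse? ≤ 2 * count (∁? canonical? ∩? selfInverse?)
      count-selfInverse = count-cover (∁? canonical? ∩? selfInverse?) τ selfInverse? covered
        where
        τ : Fin 2 → Fin r → Fin r
        τ Fin.zero    x = x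
        τ (Fin.suc _) x = h ∙ x
        covered : SelfInverse ⊆ Image (∁? canonical? ∩? selfInverse?) τ
        covered {x} x≡x⁻¹ with canonical? x | canonical? (h ∙ x)
        ... | no ¬cx | _       = Fin.zero , x , (¬cx , x≡x⁻¹) , refl
        ... | yes cx | yes chx = contradiction (identityˡ-unique h x (trans (translate-canonical h∈⟨h⟩ h≢ε cx chx) (sym x≡x⁻¹))) h≢ε
        ... | yes _  | no ¬chx = Fin.suc Fin.zero , h ∙ x , (¬chx , hx≡[hx]⁻¹) ,
                                  sym (trans (sym (assoc h h x)) (trans (cong (_∙ x) h∙h≡ε) (identityˡ x)))
          where
          hx≡[hx]⁻¹ : h ∙ x ≡ (h ∙ x) ⁻¹
          hx≡[hx]⁻¹ = trans (cong₂ _∙_ h≡h⁻¹ x≡x⁻¹) (⁻¹-∙-comm h x)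

    -- Unless h ≡ h⁻¹, one of x, hx, h⁻¹x is non-canonical. If h ≡ h⁻¹, the exceptions satisfy
    -- hx ≡ x⁻¹, a coset of the self-inverse elements, and a canonical self-inverse x has a
    -- non-canonical self-inverse hx.
    r≤6*count-free : r ≤ 6 * count free?
    r≤6*count-free with h Fin.≟ h ⁻¹
    ... | no h≢h⁻¹ = begin
      r                             ≤⟨ r≤3*count-nonCanonical h≢h⁻¹ ⟩
      3 * count (∁? canonical?)     ≤⟨ *-monoʳ-≤ 3 count-nonCanonical≤2*count-free ⟩
      3 * (2 * count free?)         ≡⟨ *-assoc 3 2 (count free?) ⟨
      6 * count free?               ∎
      where open ≤-Reasoning
    ... | yes h≡h⁻¹ = begin
      r                                                          ≤⟨ r≤2*count-nonCanonical+count-flipped h≡h⁻¹ ⟩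
      2 * count (∁? canonical?) + count (flipped? h≡h⁻¹)         ≤⟨ +-monoʳ-≤ _ (count-flipped≤count-selfInverse h≡h⁻¹) ⟩
      2 * count (∁? canonical?) + count selfInverse?             ≤⟨ +-monoʳ-≤ _ (count-selfInverse h≡h⁻¹) ⟩
      2 * count (∁? canonical?) + 2 * count (∁? canonical? ∩? selfInverse?)
        ≤⟨ +-mono-≤ (*-monoʳ-≤ 2 count-nonCanonical≤2*count-free)
                    (*-monoʳ-≤ 2 (count-mono (∁? canonical? ∩? selfInverse?) free? λ (¬c , si) → ¬c , SelfInverse-IsRep si)) ⟩
      2 * (2 * count free?) + 2 * count free?                    ≡⟨ cong (_+ 2 * count free?) (*-assoc 2 2 (count free?)) ⟨
      4 * count free? + 2 * count free?                          ≡⟨ *-distribʳ-+ (count free?) 4 2 ⟨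
      6 * count free?                                            ∎
      where open ≤-Reasoning

  module _ {S : Subset r} (S-inv : InvClosed G S) (periodic : Periodic S h) where

    ⟨h⟩-invariant : ⟨h⟩ ⊆ Periodic S
    ⟨h⟩-invariant = span-ind (Periodic S) (h ∷ []) (refl ∷ [])
      (λ u → cong (lookup S) (identityˡ u)) step
      where
      step : ∀ {g a} → g ≡ h → Periodic S a → Periodic S (g ∙ a)
      step {a = a} refl a-inv u = trans (cong (lookup S) (assoc h a u)) (trans (periodic (a ∙ u)) (a-inv u))

    orbit-constant : ∀ {x z} → Orbit x z → lookup S z ≡ lookup S x
    orbit-constant {x} (a , a∈ , inj₁ refl) = ⟨h⟩-invariant a∈ x
    orbit-constant {x} (a , a∈ , inj₂ refl) = trans (lookup-⁻¹ S-inv (a ∙ x)) (⟨h⟩-invariant a∈ x)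

module NotTwinFree {r : ℕ} (G : FinAbGroup r) where

  open FinAbGroup G using (_∙_; ε; _⁻¹)
  open GroupTheory G
  open InverseClasses G

  Period : Subset r → Pred (Fin r) 0ℓ
  Period S h = h ≢ ε × Periodic S h

  period? : ∀ S → Decidable (Period S)
  period? S h = ¬? (h Fin.≟ ε) ×-dec Fin.all? (λ u → lookup S (h ∙ u) ≟ᵇ lookup S u)

  choose : ∀ {S} → Dec (∃ (Period S)) → Fin r
  choose (yes (h , _)) = h
  choose (no _)        = ε

  periodOf : Subset r → Fin r
  periodOf S = choose {S} (Fin.any? (period? S))

  periodOf-Period : ∀ {S} → ∃ (Period S) → Period S (periodOf S)
  periodOf-Period {S} found = chosen (Fin.any? (period? S))
    where
    chosen : ∀ d → Period S (choose {S} d)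
    chosen (yes (_ , period)) = period
    chosen (no none)          = contradiction found none

  Twins : Subset r → Fin r → Fin r → Set
  Twins S x y = ∀ z → (Adj G S x z → Adj G S y z) × (Adj G S y z → Adj G S x z)

  twins? : ∀ S x y → Dec (Twins S x y)
  twins? S x y = Fin.all? λ z → ((_ ∈? S) →-dec (_ ∈? S)) ×-dec ((_ ∈? S) →-dec (_ ∈? S))

  twins : ∀ {S} → ¬ TwinFree G S → ∃₂ λ x y → Twins S x y × x ≢ y
  twins {S} ¬twinFree with Fin.¬∀⟶∃¬ r _ (λ x → Fin.all? λ y → twins? S x y →-dec (x Fin.≟ y)) ¬twinFree
  ... | x , ¬∀y with Fin.¬∀⟶∃¬ r _ (λ y → twins? S x y →-dec (x Fin.≟ y)) ¬∀y
  ...   | y , ¬[twins⇒≡] = x , y , ¬→⇒×¬ (twins? S x y) ¬[twins⇒≡]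

  twins⇒period : ∀ {S x y} → Twins S x y → x ≢ y → Period S (x ∙ y ⁻¹)
  twins⇒period {S} {x} {y} twin x≢y = (λ eq → x≢y (x∙y⁻¹≈ε⇒x≈y x y eq)) , λ u →
    lookup-≡ (λ hu∈S → subst (_∈ S) (y∙x∙x⁻¹≡y x u) (proj₂ (twin (u ∙ x)) (subst (_∈ S) (sym (shift u)) hu∈S)))
             (λ u∈S → subst (_∈ S) (shift u) (proj₁ (twin (u ∙ x)) (subst (_∈ S) (sym (y∙x∙x⁻¹≡y x u)) u∈S)))
    where
    shift : ∀ u → u ∙ x ∙ y ⁻¹ ≡ x ∙ y ⁻¹ ∙ u
    shift u = trans (assoc u x (y ⁻¹)) (comm u (x ∙ y ⁻¹))

  count-not-twin-free : ∀ {L} → Unique L → All (λ S → InvClosed G S × ¬ TwinFree G S) L →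
    length L * 2 ^ ⌈ r / 6 ⌉ ≤ r * numInvClosed G
  count-not-twin-free {L} L-unique hL =
    subst (λ n → length L * 2 ^ ⌈ r / 6 ⌉ ≤ n * numInvClosed G) (length-allFin r)
      (Compression.compression G (allFin r) periodOf (λ S → ∈-allFin (periodOf S))
        (λ h → ∁ (Orbits.Canonical G h)) (λ h → ∁? (Orbits.canonical? G h))
        (λ h {x} ¬cx cx⁻¹ → ¬cx (Orbits.Canonical-≡± G h (≡±-sym (≡±-⁻¹ x)) cx⁻¹))
        ⌈ r / 6 ⌉ L-unique inv enough determined)
    where
    inv : ∀ {S} → S ∈ₗ L → InvClosed G S
    inv S∈L = proj₁ (All.lookup hL S∈L)
    period : ∀ {S} → S ∈ₗ L → Period S (periodOf S)
    period {S} S∈L with twins (proj₂ (All.lookup hL S∈L))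
    ... | x , y , twin , x≢y = periodOf-Period {S} (_ , twins⇒period twin x≢y)
    enough : ∀ {S} → S ∈ₗ L → ⌈ r / 6 ⌉ ≤ count (Orbits.free? G (periodOf S))
    enough S∈L = ⌈/⌉-least 6 (Orbits.r≤6*count-free G _ (proj₁ (period S∈L)))
    determined : ∀ {S T} → S ∈ₗ L → T ∈ₗ L → periodOf S ≡ periodOf T →
      (∀ x → ¬ ¬ Orbits.Canonical G (periodOf S) x → lookup S x ≡ lookup T x) → S ≡ T
    determined {S} {T} S∈L T∈L same agree = lookup-ext λ x → begin
      lookup S x                ≡⟨ orbit-constant (inv S∈L) (proj₂ (period S∈L)) (orbit-orbitRep x) ⟨
      lookup S (orbitRep x)     ≡⟨ agree (orbitRep x) (λ ¬c → ¬c (Canonical-orbitRep x)) ⟩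
      lookup T (orbitRep x)     ≡⟨ orbit-constant (inv T∈L) (subst (Periodic T) (sym same) (proj₂ (period T∈L)))
                                     (orbit-orbitRep x) ⟩
      lookup T x                ∎
      where
      open ≡-Reasoning
      open Orbits G (periodOf S)

lemma3p3 : ∀ (r : ℕ) (G : FinAbGroup r) → ExponentGreaterThan2 G →
    (∀ (L : List (Subset r)) → Unique L →
       All (λ S → InvClosed G S × ¬ Connected G S) L →
       RatioLeBoundAB (length L) (numInvClosed G) r)
    × (∀ (L : List (Subset r)) → Unique L →
       All (λ S → InvClosed G S × Connected G S × Bipartite G S) L →
       RatioLeBoundAB (length L) (numInvClosed G) r)
    × (∀ (L : List (Subset r)) → Unique L →
       All (λ S → InvClosed G S × ¬ TwinFree G S) L →
       RatioLeBoundC (length L) (numInvClosed G) r)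
lemma3p3 r G exponent>2 with log₂-bracket r (>-nonZero⁻¹ r {{Fin.nonZeroIndex (FinAbGroup.ε G)}})
... | kk , 2^kk≤r , r<2^[1+kk] =
  (λ L L-unique hL → boundAB (length L) (numInvClosed G)
    (Disconnected.count-disconnected G kk r<2^[1+kk] L-unique hL)) ,
  (λ L L-unique hL → boundAB (length L) (numInvClosed G)
    (ConnectedBipartite.count-bipartite G (GroupTheory.exponent>2⇒nontrivial G exponent>2) kk r<2^[1+kk] L-unique hL)) ,
  (λ L L-unique hL → boundC (length L) (numInvClosed G)
    (NotTwinFree.count-not-twin-free G L-unique hL))
  where
  boundAB : ∀ a b → a * 2 ^ ⌈ r / 4 ⌉ ≤ r ^ kk * b → RatioLeBoundAB a b r
  boundAB a b a2ᵏ≤rᵏᵏb = Log2RatioLeKSqLog2-intro kk 2^kk≤r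
    (≤-trans (*-2^-bound a ⌈ r / 4 ⌉ 4 (≤-*-⌈/⌉ r 4) a2ᵏ≤rᵏᵏb)
      (≤-reflexive (trans (^-distribʳ-* (r ^ kk) b 4) (cong (_* b ^ 4) (^-*-assoc r kk 4)))))

  boundC : ∀ a b → a * 2 ^ ⌈ r / 6 ⌉ ≤ r * b → RatioLeBoundC a b r
  boundC a b a2ᵏ≤rb = ≤-trans (*-2^-bound a ⌈ r / 6 ⌉ 6 (≤-*-⌈/⌉ r 6) a2ᵏ≤rb)
    (^-monoˡ-≤ 6 (≤-trans (m≤n*m (r * b) 2) (≤-reflexive (sym (*-assoc 2 r b)))))
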